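{- Let $n\ge1$ and $\alpha\in\mathbb{Z}^n$. Then \[ \mathrm{Tes}_\alpha(1,1)=\sum_{\pi\in\mathcal{OSP}_{n,\operatorname{set}(\alpha)}}\prod_{i=1}^n\operatorname{tail}_i(\alpha,\pi)=\alpha_1\prod_{i=2}^{n}\bigl(\alpha_1+\alpha_2+\dots+\alpha_{i-1}+(n+2-i)\alpha_i\bigr), \] i.e. $\alpha_1(\alpha_1+n\alpha_2)(\alpha_1+\alpha_2+(n-1)\alpha_3)\cdots(\alpha_1+\dots+\alpha_{n-1}+2\alpha_n)$.
   Context: Tesler matrices: an $n\times n$ integer matrix $U$ is Tesler if upper triangular, with no zero row, each row entirely $\ge0$ or entirely $\le0$; $\operatorname{hooks}_i(U)=(U_{i,i}+\dots+U_{i,n})-(U_{1,i}+\dots+U_{i-1,i})$; $\mathrm{Tes}(\alpha)$ is the set of such $U$ with $\operatorname{hooks}(U)=\alpha$. With $M=(1-q)(1-t)$ and $[k]_{q,t}=(q^k-t^k)/(q-t)$, $\operatorname{wt}(U;q,t)=(-1)^{\operatorname{entries}^+(U)-\operatorname{rows}^+(U)}M^{\operatorname{nonzero}(U)-n}\prod_{U_{i,j}\ne0}[U_{i,j}]_{q,t}$ (number of positive entries; number of rows whose nonzero entries are all positive; number of nonzero entries); $\mathrm{Tes}_\alpha(q,t)=\sum_{U\in\mathrm{Tes}(\alpha)}\operatorname{wt}(U;q,t)\in\mathbb{Z}[q,t,1/q,1/t]$, and $\mathrm{Tes}_\alpha(1,1)$ is its value at $q=t=1$. $\operatorname{set}(\alpha)=\{i:\alpha_i\ne0\}$;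 $\mathcal{OSP}_{n,S}$ is the set of ordered set partitions $\pi=\pi_1|\pi_2|\cdots$ of $\{1,\dots,n\}$ whose set of block minima is $S$; $\operatorname{bl}_i(\pi)$ is the index of the block containing $i$. Let $m_i(\pi)=1+r$ where $r$ is the largest index $r<\operatorname{bl}_i(\pi)$ such that $\pi_r$ contains an element larger than $i$ ($m_i(\pi)=1$ if none), and $\operatorname{tail}_i(\alpha,\pi)=\sum_{r=m_i(\pi)}^{\operatorname{bl}_i(\pi)}\alpha_{\min\pi_r}$. -}

module Defs where

open import Data.Bool using (Bool; true; false; if_then_else_; _∧_; _∨_; not)
open import Data.Nat using (ℕ; zero; suc; _∸_) renaming (_+_ to _+ℕ_; _<_ to _<ℕ_; _≡ᵇ_ to _≡ℕᵇ_; _<ᵇ_ to _<ℕᵇ_; _≤ᵇ_ to _≤ℕᵇ_)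
open import Data.Integer using (ℤ; +_; _+_; _-_; _*_; -_; _≤_; _<_; _^_; _≟_; _≤?_; _<?_)
open import Data.Fin using (Fin; toℕ)
import Data.Fin as Fin
open import Data.Vec using (Vec; lookup; head)
open import Data.List using (List; []; _∷_; map; foldr; upTo; allFin)
open import Data.List.Membership.Propositional using (_∈_)
open import Data.List.Relation.Unary.Unique.Propositional using (Unique)
open import Data.Product using (∃; _×_)
open import Data.Sum using (_⊎_)
open import Relation.Binary.PropositionalEquality using (_≡_; _≢_)
open import Relation.Nullary using (does)

sumℤ : List ℤ → ℤ
sumℤ = foldr _+_ (+ 0)

prodℤ : List ℤ → ℤ
prodℤ = foldr _*_ (+ 1)

Σᶠ : ∀ {n} → (Fin n → ℤ) → ℤ
Σᶠ {n} f = sumℤ (map f (allFin n))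

Πᶠ : ∀ {n} → (Fin n → ℤ) → ℤ
Πᶠ {n} f = prodℤ (map f (allFin n))

countᶠ : ∀ {n} → (Fin n → Bool) → ℕ
countᶠ {n} p = foldr (λ i acc → if p i then suc acc else acc) 0 (allFin n)

anyᶠ : ∀ {n} → (Fin n → Bool) → Bool
anyᶠ {n} p = foldr (λ i acc → p i ∨ acc) false (allFin n)

allᶠ : ∀ {n} → (Fin n → Bool) → Bool
allᶠ {n} p = foldr (λ i acc → p i ∧ acc) true (allFin n)

Enumerates : ∀ {A : Set} → (A → Set) → List A → Set
Enumerates {A} P L = Unique L × (∀ (x : A) → x ∈ L → P x) × (∀ (x : A) → P x → x ∈ L)

-- Tesler matrices (indices 0-based: Fin n stands for {1,…,n})

Matrix : ℕ → Set
Matrix n = Vec (Vec ℤ n) n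

entry : ∀ {n} → Matrix n → Fin n → Fin n → ℤ
entry U i j = lookup (lookup U i) j

hooks : ∀ {n} → Matrix n → Fin n → ℤ
hooks U i =
  Σᶠ (λ j → if toℕ i ≤ℕᵇ toℕ j then entry U i j else + 0)
  - Σᶠ (λ k → if toℕ k <ℕᵇ toℕ i then entry U k i else + 0)

record IsTesler {n : ℕ} (α : Vec ℤ n) (U : Matrix n) : Set where
  field
    upperTriangular : ∀ i j → toℕ j <ℕ toℕ i → entry U i j ≡ + 0
    noZeroRow       : ∀ i → ∃ λ j → entry U i j ≢ + 0
    rowSigned       : ∀ i → (∀ j → + 0 ≤ entry U i j) ⊎ (∀ j → entry U i j ≤ + 0)
    hooksEq         : ∀ i → hooks U i ≡ lookup α i

isNonzero : ℤ → Bool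
isNonzero x = not (does (x ≟ + 0))

isPositive : ℤ → Bool
isPositive x = does (+ 0 <? x)

entriesPos : ∀ {n} → Matrix n → ℕ
entriesPos U = foldr _+ℕ_ 0 (map (λ i → countᶠ (λ j → isPositive (entry U i j))) (allFin _))

rowsPos : ∀ {n} → Matrix n → ℕ
rowsPos U = countᶠ (λ i → allᶠ (λ j → not (isNonzero (entry U i j)) ∨ isPositive (entry U i j)))

nonzeroCount : ∀ {n} → Matrix n → ℕ
nonzeroCount U = foldr _+ℕ_ 0 (map (λ i → countᶠ (λ j → isNonzero (entry U i j))) (allFin _))

negOnePow : ℕ → ℤ
negOnePow zero    = + 1
negOnePow (suc k) = - negOnePow k

-- M = (1-q)(1-t) evaluated at q = t = 1
M₁₁ : ℤ
M₁₁ = (+ 1 - + 1) * (+ 1 - + 1)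

-- [k]_{q,t} = (q^k - t^k)/(q - t) evaluated at q = t = 1 (equals k, also for k < 0)
qtInt₁₁ : ℤ → ℤ
qtInt₁₁ k = k

wt₁₁ : ∀ {n} → Matrix n → ℤ
wt₁₁ {n} U =
  negOnePow (entriesPos U ∸ rowsPos U)
  * (M₁₁ ^ (nonzeroCount U ∸ n))
  * Πᶠ (λ i → Πᶠ (λ j → if isNonzero (entry U i j) then qtInt₁₁ (entry U i j) else + 1))

-- Ordered set partitions, encoded by block indices:
-- b : Vec ℕ n,  lookup b i = bl_i(π) - 1  (0-based block index of i).

-- π is an ordered set partition (nonempty blocks 0,…,k-1) whose set of
-- block minima is set(α) = {i | α_i ≠ 0}.
record IsOSP {n : ℕ} (α : Vec ℤ n) (b : Vec ℕ n) : Set where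
  field
    blocksNonempty : ∀ i r → r <ℕ lookup b i → ∃ λ j → lookup b j ≡ r
    minIsSupp      : ∀ i → (∀ j → toℕ j <ℕ toℕ i → lookup b j ≢ lookup b i) → lookup α i ≢ + 0
    suppIsMin      : ∀ i → lookup α i ≢ + 0 → (∀ j → toℕ j <ℕ toℕ i → lookup b j ≢ lookup b i)

-- α_{min π_r}  (value of α at the least element of block r)
αAtMin : ∀ {n} → Vec ℤ n → Vec ℕ n → ℕ → ℤ
αAtMin {n} α b r = foldr (λ i acc → if lookup b i ≡ℕᵇ r then lookup α i else acc) (+ 0) (allFin n)

hasLarger : ∀ {n} → Vec ℕ n → Fin n → ℕ → Bool
hasLarger b i r = anyᶠ (λ j → (toℕ i <ℕᵇ toℕ j) ∧ (lookup b j ≡ℕᵇ r))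

-- 0-based version of m_i(π): 1 + largest r < bl_i with block r having an
-- element larger than i, in 0-based block indices; 0 if none.
startFrom : ∀ {n} → Vec ℕ n → Fin n → ℕ → ℕ
startFrom b i zero    = zero
startFrom b i (suc r) = if hasLarger b i r then suc r else startFrom b i r

mIdx : ∀ {n} → Vec ℕ n → Fin n → ℕ
mIdx b i = startFrom b i (lookup b i)

rangeℕ : ℕ → ℕ → List ℕ
rangeℕ a c = map (a +ℕ_) (upTo (suc c ∸ a))

tail : ∀ {n} → Vec ℤ n → Vec ℕ n → Fin n → ℤ
tail α b i = sumℤ (map (αAtMin α b) (rangeℕ (mIdx b i) (lookup b i)))

ospTerm : ∀ {n} → Vec ℤ n → Vec ℕ n → ℤ
ospTerm α b = Πᶠ (tail α b)

prefixSum : ∀ {n} → Vec ℤ n → ℕ → ℤ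
prefixSum α k = Σᶠ (λ j → if toℕ j <ℕᵇ k then lookup α j else + 0)

productFormula : ∀ m → Vec ℤ (suc m) → ℤ
productFormula m α =
  head α * Πᶠ (λ (i : Fin m) →
    prefixSum α (suc (toℕ i)) + (+ (suc m ∸ toℕ i)) * lookup α (Fin.suc i))

-- Both sides satisfy the recursion tesRec in the first coordinate: for α = a ∷ β the value is
-- a · (value at β + Σⱼ value at β + a eⱼ).
--
-- Removing the first row r and first column of a Tesler matrix with hooks α leaves
-- a Tesler matrix with hooks β + (r₂, …, rₙ), and r ranges over the one-signed nonzero rows of
-- sum a. At q = t = 1 the factor M^(nonzero(U) - n) vanishes unless every row has exactly one
-- nonzero entry; then the sign is +1, r = a eₖ, and the weight is a times the weight of the rest.
--
-- Deleting the element 1 (always a block minimum, with tail α₁) from an ordered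
-- set partition of {1,…,n} leaves one of {2,…,n}: 1 was a singleton last block (contributing
-- a · term at β), a singleton block just before the block of a minimum j, or it joined the block
-- of some j ∉ set(α). In the last two cases the tails are those of β + a eⱼ, as α₁ is now counted
-- in j's block.
--
-- Finally tesRec equals the product formula by an induction in which the running prefix sum is
-- kept as a parameter (prefixProduct).

module Submission where

open import Defs
open import Data.Bool using (Bool; true; false; if_then_else_; _∧_; _∨_; not)
open import Data.Bool.Properties using (T-≡; ∧-zeroʳ; ∨-zeroʳ; ∧-conicalʳ)
open import Data.Nat using (ℕ; zero; suc; s≤s; z≤n; _≤_; _<_; _≤ᵇ_; _<ᵇ_; _≡ᵇ_; _∸_; _⊔_)
import Data.Nat as N
import Data.Nat.Properties as NP
open import Data.Integer using (ℤ; +_; -[1+_]; _+_; _*_; _-_; -_; _≟_; +≤+; ∣_∣) renaming (_≤_ to _≤ℤ_)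
import Data.Integer.Properties as ℤP
open import Data.Integer.Tactic.RingSolver using (solve-∀)
open import Data.Fin using (Fin; zero; suc; toℕ; fromℕ<)
import Data.Fin.Properties as FP
open import Data.Vec using (Vec; []; _∷_; lookup; zipWith)
import Data.Vec as V
open import Data.Vec.Properties using (lookup-map; lookup-zipWith; lookup-replicate)
open import Data.List using (List; []; _∷_; map; foldr; concatMap; tabulate; allFin; applyUpTo; upTo; _++_; filter)
open import Data.List.Properties using (map-tabulate; map-cong)
open import Data.List.Membership.Propositional using (_∈_; _∉_)
open import Data.List.Membership.Propositional.Properties using (∈-map⁺; ∈-map⁻; ∈-++⁺ˡ; ∈-++⁺ʳ; ∈-++⁻; ∈-filter⁺; ∈-filter⁻)
open import Data.List.Relation.Unary.Any using (here; there)
open import Data.List.Relation.Unary.All using ([])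
open import Data.List.Relation.Unary.All.Properties.Core using (¬Any⇒All¬)
open import Data.List.Relation.Unary.AllPairs using ([]; _∷_)
open import Data.List.Relation.Unary.Unique.Propositional using (Unique)
open import Data.List.Relation.Unary.Unique.Propositional.Properties using (Unique[x∷xs]⇒x∉xs; map⁺; ++⁺; filter⁺)
open import Data.Product using (∃; Σ; _×_; _,_; proj₁; proj₂)
open import Data.Sum using (_⊎_; inj₁; inj₂)
import Data.Sum as Sum
open import Data.Empty using (⊥; ⊥-elim)
open import Relation.Nullary using (¬_; Dec; yes; no)
open import Relation.Unary using (Decidable)
open import Relation.Binary.PropositionalEquality
open import Function.Bundles using (Equivalence)
open import Relation.Binary.Definitions using (tri<; tri≈; tri>)

private
  variable
    A B : Set

open IsTesler

foldr-tabulate : ∀ {X Y : Set} {n} (g : X → Y → Y) z (f : Fin n → X) →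
  foldr g z (tabulate f) ≡ foldr (λ i → g (f i)) z (allFin n)
foldr-tabulate {n = zero} g z f = refl
foldr-tabulate {n = suc n} g z f = cong (g (f zero))
  (trans (foldr-tabulate g z (λ i → f (suc i))) (sym (foldr-tabulate (λ i → g (f i)) z suc)))

foldr-allFin-suc : ∀ {Y : Set} {n} (g : Fin (suc n) → Y → Y) z →
  foldr g z (allFin (suc n)) ≡ g zero (foldr (λ i → g (suc i)) z (allFin n))
foldr-allFin-suc g z = cong (g zero) (foldr-tabulate g z suc)

foldr-map-allFin-suc : ∀ {X Y : Set} {n} (g : X → Y → Y) z (f : Fin (suc n) → X) →
  foldr g z (map f (allFin (suc n))) ≡ g (f zero) (foldr g z (map (λ i → f (suc i)) (allFin n)))
foldr-map-allFin-suc {n = n} g z f = cong (g (f zero))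
  (cong (foldr g z) (trans (map-tabulate {n = n} suc f) (sym (map-tabulate {n = n} (λ i → i) (λ i → f (suc i))))))

Σᶠ-suc : ∀ {n} (f : Fin (suc n) → ℤ) → Σᶠ f ≡ f zero + Σᶠ (λ i → f (suc i))
Σᶠ-suc = foldr-map-allFin-suc _+_ (+ 0)

Πᶠ-suc : ∀ {n} (f : Fin (suc n) → ℤ) → Πᶠ f ≡ f zero * Πᶠ (λ i → f (suc i))
Πᶠ-suc = foldr-map-allFin-suc _*_ (+ 1)

Σᶠ-cong : ∀ {n} {f g : Fin n → ℤ} → (∀ i → f i ≡ g i) → Σᶠ f ≡ Σᶠ g
Σᶠ-cong {zero} e = refl
Σᶠ-cong {suc n} {f} {g} e = trans (Σᶠ-suc f) (trans (cong₂ _+_ (e zero) (Σᶠ-cong (λ i → e (suc i)))) (sym (Σᶠ-suc g)))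

Πᶠ-cong : ∀ {n} {f g : Fin n → ℤ} → (∀ i → f i ≡ g i) → Πᶠ f ≡ Πᶠ g
Πᶠ-cong {zero} e = refl
Πᶠ-cong {suc n} {f} {g} e = trans (Πᶠ-suc f) (trans (cong₂ _*_ (e zero) (Πᶠ-cong (λ i → e (suc i)))) (sym (Πᶠ-suc g)))

Σᶠ-zero : ∀ {n} (f : Fin n → ℤ) → (∀ i → f i ≡ + 0) → Σᶠ f ≡ + 0
Σᶠ-zero {zero} f e = refl
Σᶠ-zero {suc n} f e = trans (Σᶠ-suc f) (cong₂ _+_ (e zero) (Σᶠ-zero _ (λ i → e (suc i))))

Σᶠ-*ˡ : ∀ {n} (c : ℤ) (f : Fin n → ℤ) → Σᶠ (λ i → c * f i) ≡ c * Σᶠ f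
Σᶠ-*ˡ {zero} c f = sym (ℤP.*-zeroʳ c)
Σᶠ-*ˡ {suc n} c f = begin
  Σᶠ (λ i → c * f i)                     ≡⟨ Σᶠ-suc (λ i → c * f i) ⟩
  c * f zero + Σᶠ (λ i → c * f (suc i))  ≡⟨ cong (λ e → c * f zero + e) (Σᶠ-*ˡ c (λ i → f (suc i))) ⟩
  c * f zero + c * Σᶠ (λ i → f (suc i))  ≡⟨ ℤP.*-distribˡ-+ c (f zero) _ ⟨
  c * (f zero + Σᶠ (λ i → f (suc i)))    ≡⟨ cong (c *_) (Σᶠ-suc f) ⟨
  c * Σᶠ f                               ∎
  where open ≡-Reasoning

addAt : ∀ {n} → Fin n → ℤ → Vec ℤ n → Vec ℤ n
addAt zero    x (b ∷ β) = b + x ∷ β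
addAt (suc j) x (b ∷ β) = b ∷ addAt j x β

lookup-addAt-≢ : ∀ {n} (β : Vec ℤ n) j a i → i ≢ j → lookup (addAt j a β) i ≡ lookup β i
lookup-addAt-≢ (b ∷ β) zero a zero ne = ⊥-elim (ne refl)
lookup-addAt-≢ (b ∷ β) zero a (suc i) ne = refl
lookup-addAt-≢ (b ∷ β) (suc j) a zero ne = refl
lookup-addAt-≢ (b ∷ β) (suc j) a (suc i) ne = lookup-addAt-≢ β j a i (λ e → ne (cong suc e))

tesRec : ∀ n → Vec ℤ n → ℤ
tesRec zero    []      = + 1
tesRec (suc n) (a ∷ β) = a * (tesRec n β + Σᶠ (λ j → tesRec n (addAt j a β)))

-- prefixProduct d k s γ = ∏_{i<k} (s + γ₀ + ⋯ + γ_{i-1} + (d + k - i) γᵢ)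
prefixProduct : ℕ → ∀ k → ℤ → Vec ℤ k → ℤ
prefixProduct d zero    s []      = + 1
prefixProduct d (suc k) s (g ∷ γ) = (s + + (d N.+ suc k) * g) * prefixProduct d k (s + g) γ

prefixProduct-recurrence : ∀ d k s x (γ : Vec ℤ k) →
  + d * prefixProduct d k s γ + Σᶠ (λ j → prefixProduct d k s (addAt j x γ))
    ≡ + (d N.+ k) * prefixProduct d k (s + x) γ
prefixProduct-recurrence d zero s x [] rewrite NP.+-identityʳ d = identity (+ d)
  where
  identity : ∀ a → a * + 1 + + 0 ≡ a * + 1
  identity = solve-∀
prefixProduct-recurrence d (suc k) s x (g ∷ γ) = begin
  + d * (c * P (s + g) γ) + Σᶠ (λ j → P′ (addAt j x (g ∷ γ)))
    ≡⟨ cong (λ e → + d * (c * P (s + g) γ) + e) (Σᶠ-suc (λ j → P′ (addAt j x (g ∷ γ)))) ⟩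
  + d * (c * P (s + g) γ) + (c′ * P (s + (g + x)) γ + Σᶠ (λ j → c * P (s + g) (addAt j x γ)))
    ≡⟨ cong (λ e → + d * (c * P (s + g) γ) + (c′ * P (s + (g + x)) γ + e)) (Σᶠ-*ˡ c (λ j → P (s + g) (addAt j x γ))) ⟩
  + d * (c * P (s + g) γ) + (c′ * P (s + (g + x)) γ + c * Σᶠ (λ j → P (s + g) (addAt j x γ)))
    ≡⟨ factor c (+ d) (P (s + g) γ) _ _ ⟩
  c * (+ d * P (s + g) γ + Σᶠ (λ j → P (s + g) (addAt j x γ))) + c′ * P (s + (g + x)) γ
    ≡⟨ cong (λ e → c * e + c′ * P (s + (g + x)) γ) (prefixProduct-recurrence d k (s + g) x γ) ⟩
  c * (+ (d N.+ k) * P (s + g + x) γ) + c′ * P (s + (g + x)) γ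
    ≡⟨ cong₂ (λ u v → c * (+ (d N.+ k) * P u γ) + c′ * P v γ) (swap s g x) (assoc-swap s g x) ⟩
  c * (+ (d N.+ k) * P (s + x + g) γ) + c′ * P (s + x + g) γ
    ≡⟨ combine D (+ (d N.+ k)) D≡1+ s g x (P (s + x + g) γ) ⟩
  D * ((s + x + D * g) * P (s + x + g) γ)
    ∎
  where
  open ≡-Reasoning
  P = prefixProduct d k
  P′ = prefixProduct d (suc k) s
  D = + (d N.+ suc k)
  c = s + D * g
  c′ = s + D * (g + x)
  D≡1+ : D ≡ + 1 + + (d N.+ k)
  D≡1+ = trans (cong +_ (NP.+-suc d k)) (ℤP.pos-+ 1 (d N.+ k))
  factor : ∀ a b r S w → b * (a * r) + (w + a * S) ≡ a * (b * r + S) + w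
  factor = solve-∀
  swap : ∀ s g x → s + g + x ≡ s + x + g
  swap = solve-∀
  assoc-swap : ∀ s g x → s + (g + x) ≡ s + x + g
  assoc-swap = solve-∀
  combine : ∀ D δ → D ≡ + 1 + δ → ∀ s g x r →
    (s + D * g) * (δ * r) + (s + D * (g + x)) * r ≡ D * ((s + x + D * g) * r)
  combine _ δ refl = identity δ
    where
    identity : ∀ δ s g x r → (s + (+ 1 + δ) * g) * (δ * r) + (s + (+ 1 + δ) * (g + x)) * r
                              ≡ (+ 1 + δ) * ((s + x + (+ 1 + δ) * g) * r)
    identity = solve-∀

tesRec-spread≡prefixProduct : ∀ m x (β : Vec ℤ m) →
  tesRec m β + Σᶠ (λ j → tesRec m (addAt j x β)) ≡ prefixProduct 1 m x β
tesRec-spread≡prefixProduct zero x [] = refl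
tesRec-spread≡prefixProduct (suc k) x (b ∷ γ) = begin
  b * (tesRec k γ + Σᶠ (λ j → tesRec k (addAt j b γ))) + Σᶠ (λ j → tesRec (suc k) (addAt j x (b ∷ γ)))
    ≡⟨ cong₂ (λ u v → b * u + v) (tesRec-spread≡prefixProduct k b γ) (Σᶠ-suc (λ j → tesRec (suc k) (addAt j x (b ∷ γ)))) ⟩
  b * P b γ + ((b + x) * (tesRec k γ + Σᶠ (λ j → tesRec k (addAt j (b + x) γ)))
    + Σᶠ (λ j → b * (tesRec k (addAt j x γ) + Σᶠ (λ j′ → tesRec k (addAt j′ b (addAt j x γ))))))
    ≡⟨ cong₂ (λ u v → b * P b γ + ((b + x) * u + v)) (tesRec-spread≡prefixProduct k (b + x) γ)
         (trans (Σᶠ-cong (λ j → cong (b *_) (tesRec-spread≡prefixProduct k b (addAt j x γ)))) (Σᶠ-*ˡ b (λ j → P b (addAt j x γ)))) ⟩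
  b * P b γ + ((b + x) * P (b + x) γ + b * Σᶠ (λ j → P b (addAt j x γ)))
    ≡⟨ factor b (P b γ) _ _ ⟩
  b * (+ 1 * P b γ + Σᶠ (λ j → P b (addAt j x γ))) + (b + x) * P (b + x) γ
    ≡⟨ cong (λ e → b * e + (b + x) * P (b + x) γ) (prefixProduct-recurrence 1 k b x γ) ⟩
  b * (+ (suc k) * P (b + x) γ) + (b + x) * P (b + x) γ
    ≡⟨ cong (λ u → b * (+ (suc k) * P u γ) + (b + x) * P u γ) (ℤP.+-comm b x) ⟩
  b * (+ (suc k) * P (x + b) γ) + (b + x) * P (x + b) γ
    ≡⟨ combine b x (+ k) (P (x + b) γ) ⟩
  (x + (+ 1 + (+ 1 + + k)) * b) * P (x + b) γ
    ∎
  where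
  open ≡-Reasoning
  P = prefixProduct 1 k
  factor : ∀ b r S w → b * r + (w + b * S) ≡ b * (+ 1 * r + S) + w
  factor = solve-∀
  combine : ∀ b x k r → b * ((+ 1 + k) * r) + (b + x) * r ≡ (x + (+ 1 + (+ 1 + k)) * b) * r
  combine = solve-∀

prefixSum-zero : ∀ {n} (β : Vec ℤ n) → prefixSum β 0 ≡ + 0
prefixSum-zero β = Σᶠ-zero (λ j → if toℕ j N.<ᵇ 0 then lookup β j else + 0) (λ _ → refl)

prefixSum-∷ : ∀ {n} a (β : Vec ℤ n) k → prefixSum (a ∷ β) (suc k) ≡ a + prefixSum β k
prefixSum-∷ a β k = Σᶠ-suc (λ j → if toℕ j N.<ᵇ suc k then lookup (a ∷ β) j else + 0)

Πᶠ-prefixSum≡prefixProduct : ∀ m s (β : Vec ℤ m) →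
  Πᶠ (λ i → s + prefixSum β (toℕ i) + + (suc m N.∸ toℕ i) * lookup β i) ≡ prefixProduct 1 m s β
Πᶠ-prefixSum≡prefixProduct zero s [] = refl
Πᶠ-prefixSum≡prefixProduct (suc k) s (b ∷ γ) =
  trans (Πᶠ-suc (λ i → s + prefixSum (b ∷ γ) (toℕ i) + + (suc (suc k) N.∸ toℕ i) * lookup (b ∷ γ) i))
    (cong₂ _*_ (trans (cong (λ e → s + e + + (suc (suc k)) * b) (prefixSum-zero (b ∷ γ))) (drop-zero s _))
      (trans (Πᶠ-cong (λ i → trans (cong (λ e → s + e + + (suc k N.∸ toℕ i) * lookup γ i) (prefixSum-∷ b γ (toℕ i)))
               (reassoc s b (prefixSum γ (toℕ i)) _)))
        (Πᶠ-prefixSum≡prefixProduct k (s + b) γ)))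
  where
  drop-zero : ∀ s w → s + + 0 + w ≡ s + w
  drop-zero = solve-∀
  reassoc : ∀ s b p w → s + (b + p) + w ≡ s + b + p + w
  reassoc = solve-∀

tesRec≡productFormula : ∀ m (α : Vec ℤ (suc m)) → tesRec (suc m) α ≡ productFormula m α
tesRec≡productFormula m (a ∷ β) = cong (a *_) (begin
  tesRec m β + Σᶠ (λ j → tesRec m (addAt j a β))
    ≡⟨ tesRec-spread≡prefixProduct m a β ⟩
  prefixProduct 1 m a β
    ≡⟨ Πᶠ-prefixSum≡prefixProduct m a β ⟨
  Πᶠ (λ i → a + prefixSum β (toℕ i) + + (suc m N.∸ toℕ i) * lookup β i)
    ≡⟨ Πᶠ-cong (λ i → cong (λ e → e + + (suc m N.∸ toℕ i) * lookup β i) (prefixSum-∷ a β (toℕ i))) ⟨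
  Πᶠ (λ i → prefixSum (a ∷ β) (suc (toℕ i)) + + (suc m N.∸ toℕ i) * lookup β i)
    ∎)
  where open ≡-Reasoning

unique-∷ : ∀ {x : A} {xs} → x ∉ xs → Unique xs → Unique (x ∷ xs)
unique-∷ {xs = xs} x∉ u = ¬Any⇒All¬ xs x∉ ∷ u

unique-tail : ∀ {x : A} {xs} → Unique (x ∷ xs) → Unique xs
unique-tail (_ ∷ u) = u

sum-extract : ∀ (f : A → ℤ) {x : A} {L} → x ∈ L → Unique L →
  Σ (List A) λ L' → (sumℤ (map f L) ≡ f x + sumℤ (map f L')) × Unique L' × x ∉ L'
    × (∀ y → y ∈ L → y ≡ x ⊎ y ∈ L') × (∀ y → y ∈ L' → y ∈ L)
sum-extract f {L = _ ∷ L} (here refl) u = L , refl , unique-tail u , Unique[x∷xs]⇒x∉xs u ,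
  (λ { y (here e) → inj₁ e ; y (there p) → inj₂ p }) , λ y p → there p
sum-extract f {x} {L = y ∷ L} (there x∈) u with sum-extract f x∈ (unique-tail u)
... | L3 , es , u3 , x∉3 , to3 , fr3 =
  y ∷ L3 , trans (cong (λ e → f y + e) es) (exchange (f y) (f x) (sumℤ (map f L3))) ,
  unique-∷ (λ y∈ → Unique[x∷xs]⇒x∉xs u (fr3 y y∈)) u3 ,
  (λ { (here e) → Unique[x∷xs]⇒x∉xs u (subst (_∈ L) e x∈) ; (there p) → x∉3 p }) ,
  (λ { z (here e) → inj₂ (here e) ; z (there p) → Sum.map (λ e → e) there (to3 z p) }) ,
  λ { z (here e) → here e ; z (there p) → there (fr3 z p) }
  where exchange : ∀ a b c → a + (b + c) ≡ b + (a + c)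
        exchange = solve-∀

sum-sameMembers : ∀ (f : A → ℤ) (L1 L2 : List A) → Unique L1 → Unique L2 →
  (∀ x → x ∈ L1 → x ∈ L2) → (∀ x → x ∈ L2 → x ∈ L1) → sumℤ (map f L1) ≡ sumℤ (map f L2)
sum-sameMembers f [] [] u1 u2 i1 i2 = refl
sum-sameMembers f [] (y ∷ L2) u1 u2 i1 i2 with i2 y (here refl)
... | ()
sum-sameMembers f (x ∷ L1) L2 u1 u2 i1 i2 with sum-extract f (i1 x (here refl)) u2
... | L2' , es , u2' , x∉ , to , fr =
  sym (trans es (cong (λ e → f x + e) (sym (sum-sameMembers f L1 L2' (unique-tail u1) u2'
    (λ y y∈ → Sum.[ (λ e → ⊥-elim (Unique[x∷xs]⇒x∉xs u1 (subst (_∈ L1) e y∈))) , (λ p → p) ] (to y (i1 y (there y∈))))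
    (λ y y∈ → Sum.[ (λ e → ⊥-elim (x∉ (subst (_∈ L2') e y∈))) , (λ p → p) ] (Sum.map (λ e → e) (λ p → p) (i2' y y∈)))))))
  where
  i2' : ∀ y → y ∈ L2' → y ≡ x ⊎ y ∈ L1
  i2' y y∈ with i2 y (fr y y∈)
  ... | here e = inj₁ e
  ... | there p = inj₂ p

enum-sum-unique : ∀ {P : A → Set} {L1 L2} (f : A → ℤ) → Enumerates P L1 → Enumerates P L2 →
  sumℤ (map f L1) ≡ sumℤ (map f L2)
enum-sum-unique f (u1 , s1 , c1) (u2 , s2 , c2) =
  sum-sameMembers f _ _ u1 u2 (λ x p → c2 x (s1 x p)) (λ x p → c1 x (s2 x p))

enum-⇔ : ∀ {P Q : A → Set} {L} → (∀ x → P x → Q x) → (∀ x → Q x → P x) →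
  Enumerates P L → Enumerates Q L
enum-⇔ pq qp (u , s , c) = u , (λ x p → pq x (s x p)) , λ x q → c x (qp x q)

enum-empty : ∀ {P : A → Set} → (∀ x → ¬ P x) → Enumerates P []
enum-empty np = [] , (λ x ()) , λ x p → ⊥-elim (np x p)

enum-map : ∀ {P : A → Set} {Q : B → Set} {L} (φ : A → B) →
  (∀ {x y} → φ x ≡ φ y → x ≡ y) → Enumerates P L →
  (∀ x → P x → Q (φ x)) → (∀ y → Q y → ∃ λ x → P x × φ x ≡ y) →
  Enumerates Q (map φ L)
enum-map {Q = Q} φ inj (u , s , c) pq qp =
  map⁺ inj u ,
  (λ y y∈ → let (x , x∈ , e) = ∈-map⁻ φ y∈ in subst Q (sym e) (pq x (s x x∈))) ,
  λ y q → let (x , px , e) = qp y q in subst (_∈ _) e (∈-map⁺ φ (c x px))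

enum-++ : ∀ {P Q R : A → Set} {L1 L2} → Enumerates P L1 → Enumerates Q L2 →
  (∀ x → P x → Q x → ⊥) → (∀ x → R x → P x ⊎ Q x) → (∀ x → P x → R x) → (∀ x → Q x → R x) →
  Enumerates R (L1 ++ L2)
enum-++ {L1 = L1} (u1 , s1 , c1) (u2 , s2 , c2) dis rpq pr qr =
  ++⁺ u1 u2 (λ (a , b) → dis _ (s1 _ a) (s2 _ b)) ,
  (λ x x∈ → Sum.[ (λ p → pr x (s1 x p)) , (λ p → qr x (s2 x p)) ] (∈-++⁻ L1 x∈)) ,
  λ x r → Sum.[ (λ p → ∈-++⁺ˡ (c1 x p)) , (λ q → ∈-++⁺ʳ L1 (c2 x q)) ] (rpq x r)

sum-++ : ∀ (f : A → ℤ) L1 L2 → sumℤ (map f (L1 ++ L2)) ≡ sumℤ (map f L1) + sumℤ (map f L2)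
sum-++ f [] L2 = sym (ℤP.+-identityˡ _)
sum-++ f (x ∷ L1) L2 = trans (cong (λ e → f x + e) (sum-++ f L1 L2)) (sym (ℤP.+-assoc (f x) _ _))

sum-map : ∀ (f : B → ℤ) (φ : A → B) L → sumℤ (map f (map φ L)) ≡ sumℤ (map (λ x → f (φ x)) L)
sum-map f φ [] = refl
sum-map f φ (x ∷ L) = cong (λ e → f (φ x) + e) (sum-map f φ L)

sum-cong : ∀ {f g : A → ℤ} L → (∀ x → x ∈ L → f x ≡ g x) → sumℤ (map f L) ≡ sumℤ (map g L)
sum-cong [] e = refl
sum-cong (x ∷ L) e = cong₂ _+_ (e x (here refl)) (sum-cong L (λ y p → e y (there p)))

sum-*ˡ : ∀ (c : ℤ) (f : A → ℤ) L → sumℤ (map (λ x → c * f x) L) ≡ c * sumℤ (map f L)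
sum-*ˡ c f [] = sym (ℤP.*-zeroʳ c)
sum-*ˡ c f (x ∷ L) = trans (cong (λ e → c * f x + e) (sum-*ˡ c f L)) (sym (ℤP.*-distribˡ-+ c (f x) _))

sum-map-* : ∀ (f : B → ℤ) (φ : A → B) (c : ℤ) (g : A → ℤ) L →
  (∀ x → x ∈ L → f (φ x) ≡ c * g x) → sumℤ (map f (map φ L)) ≡ c * sumℤ (map g L)
sum-map-* f φ c g L h = trans (sum-map f φ L) (trans (sum-cong L h) (sum-*ˡ c g L))

sum-filter : ∀ {Q : A → Set} (Q? : Decidable Q) (f : A → ℤ) L → (∀ x → x ∈ L → ¬ Q x → f x ≡ + 0) →
  sumℤ (map f L) ≡ sumℤ (map f (filter Q? L))
sum-filter Q? f [] z = refl
sum-filter Q? f (x ∷ L) z with Q? x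
... | yes q = cong (λ e → f x + e) (sum-filter Q? f L (λ y p → z y (there p)))
... | no nq = trans (cong₂ _+_ (z x (here refl) nq) (sum-filter Q? f L (λ y p → z y (there p)))) (ℤP.+-identityˡ _)

enum-filter : ∀ {P Q R : A → Set} (Q? : Decidable Q) {L} → Enumerates P L →
  (∀ x → R x → P x × Q x) → (∀ x → P x → Q x → R x) → Enumerates R (filter Q? L)
enum-filter Q? (u , s , c) rpq pqr =
  filter⁺ Q? u ,
  (λ x x∈ → let (x∈L , q) = ∈-filter⁻ Q? x∈ in pqr x (s x x∈L) q) ,
  λ x r → let (p , q) = rpq x r in ∈-filter⁺ Q? (c x p) q

concatᶠ : ∀ {n} → (Fin n → List A) → List A
concatᶠ {n = zero} L = []
concatᶠ {n = suc n} L = L zero ++ concatᶠ (λ k → L (suc k))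

sum-concatᶠ : ∀ {n} (f : A → ℤ) (L : Fin n → List A) →
  sumℤ (map f (concatᶠ L)) ≡ Σᶠ (λ k → sumℤ (map f (L k)))
sum-concatᶠ {n = zero} f L = refl
sum-concatᶠ {n = suc n} f L = trans (sum-++ f (L zero) _)
  (trans (cong (λ e → sumℤ (map f (L zero)) + e) (sum-concatᶠ f (λ k → L (suc k))))
         (sym (Σᶠ-suc (λ k → sumℤ (map f (L k))))))

enum-concatᶠ : ∀ {n} {P : A → Set} (Q : Fin n → A → Set) (L : Fin n → List A) →
  (∀ k → Enumerates (Q k) (L k)) → (∀ x k k' → Q k x → Q k' x → k ≡ k') →
  (∀ x → P x → ∃ λ k → Q k x) → (∀ x k → Q k x → P x) → Enumerates P (concatᶠ L)
enum-concatᶠ {n = zero} Q L e dis pq qp = enum-empty λ x p → case x (pq x p)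
  where case : ∀ x → ∃ (λ (k : Fin 0) → Q k x) → ⊥
        case x (() , _)
enum-concatᶠ {n = suc n} {P = P} Q L e dis pq qp =
  enum-++ (e zero) rest
    (λ x q0 (k , qk) → FP.0≢1+n (dis x zero (suc k) q0 qk))
    (λ x p → split x (pq x p)) (λ x q → qp x zero q) (λ x (k , q) → qp x (suc k) q)
  where
  rest : Enumerates (λ x → ∃ λ k → Q (suc k) x) (concatᶠ (λ k → L (suc k)))
  rest = enum-concatᶠ (λ k → Q (suc k)) (λ k → L (suc k)) (λ k → e (suc k))
    (λ x k k' a b → FP.suc-injective (dis x (suc k) (suc k') a b))
    (λ x z → z) (λ x k q → k , q)
  split : ∀ x → ∃ (λ k → Q k x) → Q zero x ⊎ ∃ (λ k → Q (suc k) x)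
  split x (zero , q) = inj₁ q
  split x (suc k , q) = inj₂ (k , q)

enum-bindL : ∀ {X : Set} (Q : X → A → Set) (I : List X) (L : X → List A) → Unique I →
  (∀ i → i ∈ I → Enumerates (Q i) (L i)) →
  (∀ x i i' → i ∈ I → i' ∈ I → Q i x → Q i' x → i ≡ i') →
  Enumerates (λ x → ∃ λ i → i ∈ I × Q i x) (concatMap L I)
enum-bindL Q [] L u e dis = enum-empty λ { x (i , () , _) }
enum-bindL Q (i ∷ I) L u e dis =
  enum-++ (e i (here refl)) rest
    (λ x q (i' , i'∈ , q') → Unique[x∷xs]⇒x∉xs u (subst (_∈ I) (sym (dis x i i' (here refl) (there i'∈) q q')) i'∈))
    (λ { x (j , here refl , q) → inj₁ q ; x (j , there j∈ , q) → inj₂ (j , j∈ , q) })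
    (λ x q → i , here refl , q) (λ { x (j , j∈ , q) → j , there j∈ , q })
  where
  rest : Enumerates (λ x → ∃ λ j → j ∈ I × Q j x) (concatMap L I)
  rest = enum-bindL Q I L (unique-tail u) (λ j j∈ → e j (there j∈)) (λ x j j' a b → dis x j j' (there a) (there b))

enum-bind : ∀ {X : Set} {R : X → Set} {P : A → Set} (Q : X → A → Set) {I : List X} (L : X → List A) →
  Enumerates R I →
  (∀ i → R i → Enumerates (Q i) (L i)) →
  (∀ x i i' → R i → R i' → Q i x → Q i' x → i ≡ i') →
  (∀ x → P x → ∃ λ i → R i × Q i x) → (∀ x i → R i → Q i x → P x) →
  Enumerates P (concatMap L I)
enum-bind Q {I} L (u , s , c) e dis pq qp =
  enum-⇔ (λ x (i , i∈ , q) → qp x i (s i i∈) q)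
            (λ x p → let (i , r , q) = pq x p in i , c i r , q)
            (enum-bindL Q I L u (λ i i∈ → e i (s i i∈)) (λ x i i' a b → dis x i i' (s i a) (s i' b)))

addTopRow : ∀ {n} → Vec ℤ (suc n) → Matrix n → Matrix (suc n)
addTopRow r U = r ∷ V.map (λ row → + 0 ∷ row) U

-- The hooks of U forced by hooks (addTopRow r U) ≡ a ∷ β, namely hooksᵢ U = βᵢ + rᵢ₊₁.
subHooks : ∀ {n} → Vec ℤ n → Vec ℤ (suc n) → Vec ℤ n
subHooks β (r0 ∷ rs) = zipWith _+_ β rs

lookup-subHooks : ∀ {n} (β : Vec ℤ n) r i → lookup (subHooks β r) i ≡ lookup β i + lookup r (suc i)
lookup-subHooks β (r0 ∷ rs) i = lookup-zipWith _+_ i β rs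

lookup-addTopRow : ∀ {n} (r : Vec ℤ (suc n)) (U : Matrix n) i → lookup (addTopRow r U) (suc i) ≡ + 0 ∷ lookup U i
lookup-addTopRow r U i = lookup-map i (λ row → + 0 ∷ row) U

addTopRow-col₀ : ∀ {n} (r : Vec ℤ (suc n)) (U : Matrix n) i → entry (addTopRow r U) (suc i) zero ≡ + 0
addTopRow-col₀ r U i = cong (λ v → lookup v zero) (lookup-addTopRow r U i)

addTopRow-entry : ∀ {n} (r : Vec ℤ (suc n)) (U : Matrix n) i j → entry (addTopRow r U) (suc i) (suc j) ≡ entry U i j
addTopRow-entry r U i j = cong (λ v → lookup v (suc j)) (lookup-addTopRow r U i)

<ᵇ-suc : ∀ i j → (i N.<ᵇ suc j) ≡ (i N.≤ᵇ j)
<ᵇ-suc zero j = refl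
<ᵇ-suc (suc i) zero = refl
<ᵇ-suc (suc i) (suc j) = refl

rowSum : ∀ {n} → Vec ℤ n → ℤ
rowSum r = Σᶠ (lookup r)

hooks-addTopRow-zero : ∀ {n} (r : Vec ℤ (suc n)) (U : Matrix n) → hooks (addTopRow r U) zero ≡ rowSum r
hooks-addTopRow-zero r U = trans (cong (λ e → rowSum r - e) (Σᶠ-zero (λ k → if toℕ k N.<ᵇ 0 then entry (addTopRow r U) k zero else + 0) (λ i → refl)))
                     (ℤP.+-identityʳ _)

hooks-addTopRow-suc : ∀ {n} (r : Vec ℤ (suc n)) (U : Matrix n) i →
  hooks (addTopRow r U) (suc i) ≡ hooks U i - lookup r (suc i)
hooks-addTopRow-suc {n} r U i = trans (cong₂ _-_ arm-suc leg-suc) (regroup arm leg (lookup r (suc i)))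
  where
  arm = Σᶠ (λ j → if toℕ i N.≤ᵇ toℕ j then entry U i j else + 0)
  leg = Σᶠ (λ k → if toℕ k N.<ᵇ toℕ i then entry U k i else + 0)
  arm-suc : Σᶠ (λ j → if suc (toℕ i) N.≤ᵇ toℕ j then entry (addTopRow r U) (suc i) j else + 0) ≡ + 0 + arm
  arm-suc = trans (Σᶠ-suc (λ j → if suc (toℕ i) N.≤ᵇ toℕ j then entry (addTopRow r U) (suc i) j else + 0)) (cong (λ e → + 0 + e) (Σᶠ-cong (λ j →
         trans (cong (λ b → if b then entry (addTopRow r U) (suc i) (suc j) else + 0) (<ᵇ-suc (toℕ i) (toℕ j)))
               (cong (λ e → if toℕ i N.≤ᵇ toℕ j then e else + 0) (addTopRow-entry r U i j)))))
  leg-suc : Σᶠ (λ k → if toℕ k N.<ᵇ suc (toℕ i) then entry (addTopRow r U) k (suc i) else + 0) ≡ lookup r (suc i) + leg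
  leg-suc = trans (Σᶠ-suc (λ k → if toℕ k N.<ᵇ suc (toℕ i) then entry (addTopRow r U) k (suc i) else + 0)) (cong (λ e → lookup r (suc i) + e) (Σᶠ-cong (λ k →
         cong (λ e → if toℕ k N.<ᵇ toℕ i then e else + 0) (addTopRow-entry r U k i))))
  regroup : ∀ a b c → + 0 + a - (c + b) ≡ a - b - c
  regroup = solve-∀

record IsTeslerRow {n} (a : ℤ) (r : Vec ℤ (suc n)) : Set where
  field
    signed : (∀ j → + 0 ≤ℤ lookup r j) ⊎ (∀ j → lookup r j ≤ℤ + 0)
    nonzero  : ∃ λ j → lookup r j ≢ + 0
    rowSum≡ : rowSum r ≡ a

tesler-addTopRow⇒row : ∀ {n} {a β} {r : Vec ℤ (suc n)} {U} → IsTesler (a ∷ β) (addTopRow r U) → IsTeslerRow a r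
tesler-addTopRow⇒row {r = r} {U} t = record
  { signed = rowSigned t zero ; nonzero = noZeroRow t zero ; rowSum≡ = trans (sym (hooks-addTopRow-zero r U)) (hooksEq t zero) }

tesler-addTopRow⇒sub : ∀ {n} {a β} {r : Vec ℤ (suc n)} {U} → IsTesler (a ∷ β) (addTopRow r U) → IsTesler (subHooks β r) U
tesler-addTopRow⇒sub {n} {a} {β} {r} {U} t = record
  { upperTriangular = λ i j j<i → trans (sym (addTopRow-entry r U i j)) (upperTriangular t (suc i) (suc j) (s≤s j<i))
  ; noZeroRow = noZeroRow′
  ; rowSigned = λ i → Sum.map (λ p j → subst (+ 0 ≤ℤ_) (addTopRow-entry r U i j) (p (suc j)))
                                    (λ p j → subst (_≤ℤ + 0) (addTopRow-entry r U i j) (p (suc j))) (rowSigned t (suc i))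
  ; hooksEq = λ i → trans (add-back (hooks U i) (lookup r (suc i)) (trans (sym (hooks-addTopRow-suc r U i)) (hooksEq t (suc i))))
                          (sym (lookup-subHooks β r i))
  }
  where
  noZeroRow′ : ∀ i → ∃ λ j → entry U i j ≢ + 0
  noZeroRow′ i with noZeroRow t (suc i)
  ... | zero , ne = ⊥-elim (ne (addTopRow-col₀ r U i))
  ... | suc j , ne = j , λ e → ne (trans (addTopRow-entry r U i j) e)
  add-back : ∀ h x {b} → h - x ≡ b → h ≡ b + x
  add-back h x refl = identity h x
    where identity : ∀ h x → h ≡ h - x + x
          identity = solve-∀

tesler-addTopRow⇐ : ∀ {n} {a β} {r : Vec ℤ (suc n)} {U} → IsTeslerRow a r →
  IsTesler (subHooks β r) U → IsTesler (a ∷ β) (addTopRow r U)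
tesler-addTopRow⇐ {n} {a} {β} {r} {U} rw t = record
  { upperTriangular = upperTriangular′ ; noZeroRow = noZeroRow′ ; rowSigned = rowSigned′ ; hooksEq = hooksEq′ }
  where
  upperTriangular′ : ∀ i j → toℕ j N.< toℕ i → entry (addTopRow r U) i j ≡ + 0
  upperTriangular′ zero j ()
  upperTriangular′ (suc i) zero _ = addTopRow-col₀ r U i
  upperTriangular′ (suc i) (suc j) (s≤s lt) = trans (addTopRow-entry r U i j) (upperTriangular t i j lt)
  noZeroRow′ : ∀ i → ∃ λ j → entry (addTopRow r U) i j ≢ + 0
  noZeroRow′ zero = IsTeslerRow.nonzero rw
  noZeroRow′ (suc i) with noZeroRow t i
  ... | j , ne = suc j , λ e → ne (trans (sym (addTopRow-entry r U i j)) e)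
  rowSigned′ : ∀ i → (∀ j → + 0 ≤ℤ entry (addTopRow r U) i j) ⊎ (∀ j → entry (addTopRow r U) i j ≤ℤ + 0)
  rowSigned′ zero = IsTeslerRow.signed rw
  rowSigned′ (suc i) = Sum.map nonneg nonpos (rowSigned t i)
    where
    nonneg : (∀ j → + 0 ≤ℤ entry U i j) → ∀ j → + 0 ≤ℤ entry (addTopRow r U) (suc i) j
    nonneg p zero = subst (+ 0 ≤ℤ_) (sym (addTopRow-col₀ r U i)) ℤP.≤-refl
    nonneg p (suc j) = subst (+ 0 ≤ℤ_) (sym (addTopRow-entry r U i j)) (p j)
    nonpos : (∀ j → entry U i j ≤ℤ + 0) → ∀ j → entry (addTopRow r U) (suc i) j ≤ℤ + 0
    nonpos p zero = subst (_≤ℤ + 0) (sym (addTopRow-col₀ r U i)) ℤP.≤-refl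
    nonpos p (suc j) = subst (_≤ℤ + 0) (sym (addTopRow-entry r U i j)) (p j)
  hooksEq′ : ∀ i → hooks (addTopRow r U) i ≡ lookup (a ∷ β) i
  hooksEq′ zero = trans (hooks-addTopRow-zero r U) (IsTeslerRow.rowSum≡ rw)
  hooksEq′ (suc i) = trans (hooks-addTopRow-suc r U i) (trans (cong (λ e → e - lookup r (suc i)) (trans (hooksEq t i) (lookup-subHooks β r i)))
                 (cancel (lookup β i) (lookup r (suc i))))
    where cancel : ∀ b x → b + x - x ≡ b
          cancel = solve-∀

zeroColumn-view : ∀ {m n} (rows : Vec (Vec ℤ (suc n)) m) → (∀ i → lookup (lookup rows i) zero ≡ + 0) →
  rows ≡ V.map (λ row → + 0 ∷ row) (V.map V.tail rows)
zeroColumn-view [] z = refl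
zeroColumn-view ((x ∷ xs) ∷ rows) z = cong₂ _∷_ (cong (_∷ xs) (z zero)) (zeroColumn-view rows (λ i → z (suc i)))

subMatrix : ∀ {n} → Matrix (suc n) → Matrix n
subMatrix (r ∷ rows) = V.map V.tail rows

tesler≡addTopRow : ∀ {n} {α} (U : Matrix (suc n)) → IsTesler α U → U ≡ addTopRow (V.head U) (subMatrix U)
tesler≡addTopRow (r ∷ rows) t = cong (r ∷_) (zeroColumn-view rows (λ i → upperTriangular t (suc i) zero (s≤s z≤n)))

addTopRow-injective : ∀ {n} {r r' : Vec ℤ (suc n)} {U U'} → addTopRow r U ≡ addTopRow r' U' → r ≡ r' × U ≡ U'
addTopRow-injective {U = U} {U'} e = cong V.head e , (trans (sym (tail-zeroColumn U)) (trans (cong subMatrix e) (tail-zeroColumn U')))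
  where
  tail-zeroColumn : ∀ {n m} (U : Vec (Vec ℤ n) m) → V.map V.tail (V.map (λ row → + 0 ∷ row) U) ≡ U
  tail-zeroColumn [] = refl
  tail-zeroColumn (x ∷ U) = cong (x ∷_) (tail-zeroColumn U)

sumᵛ : ∀ {m} → Vec ℕ m → ℕ
sumᵛ [] = 0
sumᵛ (x ∷ v) = x N.+ sumᵛ v

compositions : ℕ → ∀ m → List (Vec ℕ m)
compositions s zero = base s
  where base : ℕ → List (Vec ℕ 0)
        base zero = [] ∷ []
        base (suc s) = []
compositions s (suc m) = concatᶠ {n = suc s} (λ x → map (toℕ x ∷_) (compositions (s ∸ toℕ x) m))

enum-compositions : ∀ s m → Enumerates (λ v → sumᵛ v ≡ s) (compositions s m)
enum-compositions zero zero = ([] ∷ []) , (λ { [] (here refl) → refl }) , λ { [] e → here refl }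
enum-compositions (suc s) zero = enum-empty λ { [] () }
enum-compositions s (suc m) = enum-concatᶠ
  (λ x v → V.head v ≡ toℕ x × sumᵛ (V.tail v) ≡ s ∸ toℕ x)
  (λ x → map (toℕ x ∷_) (compositions (s ∸ toℕ x) m))
  (λ x → enum-map (toℕ x ∷_) (λ e → cong V.tail e) (enum-compositions (s ∸ toℕ x) m)
           (λ v e → refl , e) (λ { (h ∷ t) (e1 , e2) → t , e2 , cong (_∷ t) (sym e1) }))
  (λ v x x' (e1 , _) (e1' , _) → FP.toℕ-injective (trans (sym e1) e1'))
  (λ { (h ∷ t) e → fromℕ< (h≤ h t e) , sym (FP.toℕ-fromℕ< (h≤ h t e)) ,
        trans (sym (NP.m+n∸m≡n h (sumᵛ t))) (cong₂ _∸_ e (sym (FP.toℕ-fromℕ< (h≤ h t e)))) })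
  (λ { (h ∷ t) x (e1 , e2) → trans (cong₂ N._+_ e1 e2) (NP.m+[n∸m]≡n (FP.toℕ≤pred[n] x)) })
  where
  h≤ : ∀ h (t : Vec ℕ m) → h N.+ sumᵛ t ≡ s → h N.< suc s
  h≤ h t e = s≤s (subst (h N.≤_) e (NP.m≤m+n h (sumᵛ t)))

rowSum-∷ : ∀ {n} x (xs : Vec ℤ n) → rowSum (x ∷ xs) ≡ x + rowSum xs
rowSum-∷ x xs = Σᶠ-suc (lookup (x ∷ xs))

rowSum-pos : ∀ {m} (c : Vec ℕ m) → rowSum (V.map (λ n → + n) c) ≡ + sumᵛ c
rowSum-pos [] = refl
rowSum-pos (x ∷ c) = trans (rowSum-∷ (+ x) (V.map (λ n → + n) c)) (cong (λ e → + x + e) (rowSum-pos c))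

rowSum-neg : ∀ {m} (r : Vec ℤ m) → rowSum (V.map (λ x → - x) r) ≡ - rowSum r
rowSum-neg [] = refl
rowSum-neg (x ∷ r) = trans (rowSum-∷ (- x) (V.map (λ x → - x) r))
  (trans (cong (λ e → - x + e) (rowSum-neg r)) (trans (sym (ℤP.neg-distrib-+ x (rowSum r))) (cong -_ (sym (rowSum-∷ x r)))))

rowSum-nonpos : ∀ {m} (r : Vec ℤ m) → (∀ j → lookup r j ≤ℤ + 0) → rowSum r ≤ℤ + 0
rowSum-nonpos [] p = ℤP.≤-refl
rowSum-nonpos (x ∷ r) p = subst (_≤ℤ + 0) (sym (rowSum-∷ x r)) (ℤP.+-mono-≤ (p zero) (rowSum-nonpos r (λ j → p (suc j))))

rowSum-nonneg : ∀ {m} (r : Vec ℤ m) → (∀ j → + 0 ≤ℤ lookup r j) → + 0 ≤ℤ rowSum r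
rowSum-nonneg [] p = ℤP.≤-refl
rowSum-nonneg (x ∷ r) p = subst (+ 0 ≤ℤ_) (sym (rowSum-∷ x r)) (ℤP.+-mono-≤ (p zero) (rowSum-nonneg r (λ j → p (suc j))))

nonneg-+≡0ˡ : ∀ {a b} → + 0 ≤ℤ a → + 0 ≤ℤ b → a + b ≡ + 0 → a ≡ + 0
nonneg-+≡0ˡ {a} 0≤a 0≤b a+b≡0 = ℤP.≤-antisym (subst₂ _≤ℤ_ (ℤP.+-identityʳ a) a+b≡0 (ℤP.+-monoʳ-≤ a 0≤b)) 0≤a

nonneg-rowSum≡0 : ∀ {m} (r : Vec ℤ m) → (∀ j → + 0 ≤ℤ lookup r j) → rowSum r ≡ + 0 → ∀ j → lookup r j ≡ + 0
nonneg-rowSum≡0 (x ∷ r) p e j = at j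
  where
  x+Σr≡0 : x + rowSum r ≡ + 0
  x+Σr≡0 = trans (sym (rowSum-∷ x r)) e
  x≡0 : x ≡ + 0
  x≡0 = nonneg-+≡0ˡ (p zero) (rowSum-nonneg r (λ j → p (suc j))) x+Σr≡0
  at : ∀ j → lookup (x ∷ r) j ≡ + 0
  at zero = x≡0
  at (suc j) = nonneg-rowSum≡0 r (λ j → p (suc j))
    (trans (sym (ℤP.+-identityˡ (rowSum r))) (trans (cong (_+ rowSum r) (sym x≡0)) x+Σr≡0)) j

positiveRows : ℕ → ∀ n → List (Vec ℤ (suc n))
positiveRows k n = map (V.map (λ n → + n)) (compositions (suc k) (suc n))

map-+-injective : ∀ {m} {c c' : Vec ℕ m} → V.map (λ n → + n) c ≡ V.map (λ n → + n) c' → c ≡ c'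
map-+-injective {c = []} {[]} e = refl
map-+-injective {c = x ∷ c} {x' ∷ c'} e = cong₂ _∷_ (ℤP.+-injective (cong V.head e)) (map-+-injective (cong V.tail e))

nonzero-of-sum : ∀ {m} (c : Vec ℕ m) k → sumᵛ c ≡ suc k → ∃ λ j → lookup (V.map (λ n → + n) c) j ≢ + 0
nonzero-of-sum [] k ()
nonzero-of-sum (zero ∷ c) k e with nonzero-of-sum c k e
... | j , ne = suc j , ne
nonzero-of-sum (suc x ∷ c) k e = zero , λ ()

nonneg-abs : ∀ {m} (r : Vec ℤ m) → (∀ j → + 0 ≤ℤ lookup r j) → V.map (λ n → + n) (V.map ∣_∣ r) ≡ r
nonneg-abs [] p = refl
nonneg-abs (x ∷ r) p = cong₂ _∷_ (ℤP.0≤i⇒+∣i∣≡i (p zero)) (nonneg-abs r (λ j → p (suc j)))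

enum-positiveRows : ∀ k n → Enumerates (IsTeslerRow (+ suc k)) (positiveRows k n)
enum-positiveRows k n = enum-map (V.map (λ n → + n)) map-+-injective (enum-compositions (suc k) (suc n))
  (λ c e → record { signed = inj₁ (λ j → subst (+ 0 ≤ℤ_) (sym (lookup-map j (λ n → + n) c)) (+≤+ z≤n))
                  ; nonzero = nonzero-of-sum c k e
                  ; rowSum≡ = trans (rowSum-pos c) (cong +_ e) })
  λ r rw → case r rw (IsTeslerRow.signed rw)
  where
  case : ∀ r → IsTeslerRow (+ suc k) r → (∀ j → + 0 ≤ℤ lookup r j) ⊎ (∀ j → lookup r j ≤ℤ + 0) → ∃ λ c → sumᵛ c ≡ suc k × V.map (λ n → + n) c ≡ r
  case r rw (inj₁ p) = V.map ∣_∣ r , ℤP.+-injective (trans (sym (rowSum-pos (V.map ∣_∣ r)))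
                         (trans (cong rowSum (nonneg-abs r p)) (IsTeslerRow.rowSum≡ rw))) , nonneg-abs r p
  case r rw (inj₂ p) with subst (_≤ℤ + 0) (IsTeslerRow.rowSum≡ rw) (rowSum-nonpos r p)
  ... | +≤+ ()

map-neg-involutive : ∀ {m} (r : Vec ℤ m) → V.map (λ x → - x) (V.map (λ x → - x) r) ≡ r
map-neg-involutive [] = refl
map-neg-involutive (x ∷ r) = cong₂ _∷_ (ℤP.neg-involutive x) (map-neg-involutive r)

lookup-map-neg : ∀ {m} (r : Vec ℤ m) j → lookup (V.map (λ x → - x) r) j ≡ - lookup r j
lookup-map-neg r j = lookup-map j -_ r

teslerRow-neg : ∀ {n} {a} (r : Vec ℤ (suc n)) → IsTeslerRow a r → IsTeslerRow (- a) (V.map (λ x → - x) r)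
teslerRow-neg {a = a} r rw = record
  { signed = Sum.[ (λ p → inj₂ (λ j → subst (_≤ℤ + 0) (sym (lookup-map-neg r j)) (ℤP.neg-mono-≤ (p j))))
                    , (λ p → inj₁ (λ j → subst (+ 0 ≤ℤ_) (sym (lookup-map-neg r j)) (ℤP.neg-mono-≤ (p j)))) ] (IsTeslerRow.signed rw)
  ; nonzero = let (j , ne) = IsTeslerRow.nonzero rw in j , λ e → ne (ℤP.neg-injective (trans (sym (lookup-map-neg r j)) e))
  ; rowSum≡ = trans (rowSum-neg r) (cong -_ (IsTeslerRow.rowSum≡ rw)) }

teslerRows : ℤ → ∀ n → List (Vec ℤ (suc n))
teslerRows (+ zero) n = []
teslerRows (+ suc k) n = positiveRows k n
teslerRows (-[1+ k ]) n = map (V.map (λ x → - x)) (positiveRows k n)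

nonneg-no-teslerRow-zero : ∀ {n} (r : Vec ℤ (suc n)) → (∀ j → + 0 ≤ℤ lookup r j) → IsTeslerRow (+ 0) r → ⊥
nonneg-no-teslerRow-zero r 0≤r rw =
  let (j , ne) = IsTeslerRow.nonzero rw in ne (nonneg-rowSum≡0 r 0≤r (IsTeslerRow.rowSum≡ rw) j)

no-teslerRow-zero : ∀ {n} (r : Vec ℤ (suc n)) → IsTeslerRow (+ 0) r → ⊥
no-teslerRow-zero r rw with IsTeslerRow.signed rw
... | inj₁ 0≤r = nonneg-no-teslerRow-zero r 0≤r rw
... | inj₂ r≤0 = nonneg-no-teslerRow-zero (V.map (λ x → - x) r)
  (λ j → subst (+ 0 ≤ℤ_) (sym (lookup-map-neg r j)) (ℤP.neg-mono-≤ (r≤0 j))) (teslerRow-neg r rw)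

enum-teslerRows : ∀ a n → Enumerates (IsTeslerRow a) (teslerRows a n)
enum-teslerRows (+ zero) n = enum-empty no-teslerRow-zero
enum-teslerRows (+ suc k) n = enum-positiveRows k n
enum-teslerRows (-[1+ k ]) n = enum-map (V.map (λ x → - x)) (λ {x} {y} e → trans (sym (map-neg-involutive x)) (trans (cong (V.map (λ x → - x)) e) (map-neg-involutive y)))
  (enum-positiveRows k n) (λ r rw → teslerRow-neg r rw)
  λ r rw → V.map (λ x → - x) r , teslerRow-neg r rw , map-neg-involutive r

teslerMatrices : ∀ n → Vec ℤ n → List (Matrix n)
teslerMatrices zero [] = [] ∷ []
teslerMatrices (suc n) (a ∷ β) = concatMap (λ r → map (addTopRow r) (teslerMatrices n (subHooks β r))) (teslerRows a n)

tesler-empty : IsTesler [] []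
tesler-empty = record { upperTriangular = λ () ; noZeroRow = λ () ; rowSigned = λ () ; hooksEq = λ () }

enum-teslerMatrices : ∀ n (α : Vec ℤ n) → Enumerates (IsTesler α) (teslerMatrices n α)
enum-teslerMatrices zero [] = ([] ∷ []) , (λ { [] (here refl) → tesler-empty }) , λ { [] _ → here refl }
enum-teslerMatrices (suc n) (a ∷ β) = enum-bind
  (λ r U → ∃ λ U' → IsTesler (subHooks β r) U' × addTopRow r U' ≡ U)
  (λ r → map (addTopRow r) (teslerMatrices n (subHooks β r)))
  (enum-teslerRows a n)
  (λ r rw → enum-map (addTopRow r) (λ e → proj₂ (addTopRow-injective e)) (enum-teslerMatrices n (subHooks β r))
     (λ U' t → U' , t , refl) (λ U (U' , t , e) → U' , t , e))
  (λ U r r' _ _ (U1 , _ , e1) (U2 , _ , e2) → proj₁ (addTopRow-injective (trans e1 (sym e2))))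
  (λ U t → V.head U , tesler-addTopRow⇒row (subst (IsTesler (a ∷ β)) (tesler≡addTopRow U t) t) ,
           subMatrix U , tesler-addTopRow⇒sub (subst (IsTesler (a ∷ β)) (tesler≡addTopRow U t) t) , sym (tesler≡addTopRow U t))
  (λ { U r rw (U' , t , refl) → tesler-addTopRow⇐ rw t })

countNonzero countPositive : ∀ {m} → Vec ℤ m → ℕ
countNonzero r = countᶠ (λ j → isNonzero (lookup r j))
countPositive r = countᶠ (λ j → isPositive (lookup r j))

allPositive : ∀ {m} → Vec ℤ m → Bool
allPositive r = allᶠ (λ j → not (isNonzero (lookup r j)) ∨ isPositive (lookup r j))

prodNonzero : ∀ {m} → Vec ℤ m → ℤ
prodNonzero r = Πᶠ (λ j → if isNonzero (lookup r j) then lookup r j else + 1)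

prodNonzeroᴹ : ∀ {n} → Matrix n → ℤ
prodNonzeroᴹ U = Πᶠ (λ i → prodNonzero (lookup U i))

countᶠ-suc : ∀ {m} (p : Fin (suc m) → Bool) →
  countᶠ p ≡ (if p zero then suc (countᶠ (λ i → p (suc i))) else countᶠ (λ i → p (suc i)))
countᶠ-suc p = foldr-allFin-suc (λ i acc → if p i then suc acc else acc) 0

allᶠ-suc : ∀ {m} (p : Fin (suc m) → Bool) → allᶠ p ≡ (p zero ∧ allᶠ (λ i → p (suc i)))
allᶠ-suc p = foldr-allFin-suc (λ i acc → p i ∧ acc) true

countNonzero-∷ : ∀ {m} x (v : Vec ℤ m) →
  countNonzero (x ∷ v) ≡ (if isNonzero x then suc (countNonzero v) else countNonzero v)
countNonzero-∷ x v = countᶠ-suc (λ j → isNonzero (lookup (x ∷ v) j))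

countPositive-∷ : ∀ {m} x (v : Vec ℤ m) →
  countPositive (x ∷ v) ≡ (if isPositive x then suc (countPositive v) else countPositive v)
countPositive-∷ x v = countᶠ-suc (λ j → isPositive (lookup (x ∷ v) j))

allPositive-∷ : ∀ {m} x (v : Vec ℤ m) → allPositive (x ∷ v) ≡ ((not (isNonzero x) ∨ isPositive x) ∧ allPositive v)
allPositive-∷ x v = allᶠ-suc (λ j → not (isNonzero (lookup (x ∷ v) j)) ∨ isPositive (lookup (x ∷ v) j))

prodNonzero-∷ : ∀ {m} x (v : Vec ℤ m) → prodNonzero (x ∷ v) ≡ (if isNonzero x then x else + 1) * prodNonzero v
prodNonzero-∷ x v = Πᶠ-suc (λ j → if isNonzero (lookup (x ∷ v) j) then lookup (x ∷ v) j else + 1)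

prodNonzero-0∷ : ∀ {m} (v : Vec ℤ m) → prodNonzero (+ 0 ∷ v) ≡ prodNonzero v
prodNonzero-0∷ v = trans (prodNonzero-∷ (+ 0) v) (ℤP.*-identityˡ _)

sumℕ-suc : ∀ {n} (f : Fin (suc n) → ℕ) →
  foldr N._+_ 0 (map f (allFin (suc n))) ≡ f zero N.+ foldr N._+_ 0 (map (λ i → f (suc i)) (allFin n))
sumℕ-suc f = foldr-map-allFin-suc N._+_ 0 f

nonzeroCount-addTopRow : ∀ {n} (r : Vec ℤ (suc n)) (U : Matrix n) →
  nonzeroCount (addTopRow r U) ≡ countNonzero r N.+ nonzeroCount U
nonzeroCount-addTopRow r U = trans (sumℕ-suc (λ i → countNonzero (lookup (addTopRow r U) i)))
  (cong (λ l → countNonzero r N.+ foldr N._+_ 0 l) (map-cong (λ i → trans (cong countNonzero (lookup-addTopRow r U i)) (countNonzero-∷ (+ 0) (lookup U i))) (allFin _)))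

entriesPos-addTopRow : ∀ {n} (r : Vec ℤ (suc n)) (U : Matrix n) →
  entriesPos (addTopRow r U) ≡ countPositive r N.+ entriesPos U
entriesPos-addTopRow r U = trans (sumℕ-suc (λ i → countPositive (lookup (addTopRow r U) i)))
  (cong (λ l → countPositive r N.+ foldr N._+_ 0 l) (map-cong (λ i → trans (cong countPositive (lookup-addTopRow r U i)) (countPositive-∷ (+ 0) (lookup U i))) (allFin _)))

countᶠ-cong : ∀ {m} {p q : Fin m → Bool} → (∀ i → p i ≡ q i) → countᶠ p ≡ countᶠ q
countᶠ-cong {zero} e = refl
countᶠ-cong {suc m} {p} {q} e = trans (countᶠ-suc p) (trans
  (cong₂ (λ b c → if b then suc c else c) (e zero) (countᶠ-cong (λ i → e (suc i)))) (sym (countᶠ-suc q)))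

rowsPos-addTopRow : ∀ {n} (r : Vec ℤ (suc n)) (U : Matrix n) →
  rowsPos (addTopRow r U) ≡ (if allPositive r then suc (rowsPos U) else rowsPos U)
rowsPos-addTopRow r U = trans (countᶠ-suc (λ i → allPositive (lookup (addTopRow r U) i)))
  (cong (λ c → if allPositive r then suc c else c) (countᶠ-cong (λ i → trans (cong allPositive (lookup-addTopRow r U i)) (allPositive-∷ (+ 0) (lookup U i)))))

prodNonzeroᴹ-addTopRow : ∀ {n} (r : Vec ℤ (suc n)) (U : Matrix n) →
  prodNonzeroᴹ (addTopRow r U) ≡ prodNonzero r * prodNonzeroᴹ U
prodNonzeroᴹ-addTopRow r U = trans (Πᶠ-suc (λ i → prodNonzero (lookup (addTopRow r U) i)))
  (cong (prodNonzero r *_) (Πᶠ-cong (λ i → trans (cong prodNonzero (lookup-addTopRow r U i)) (prodNonzero-0∷ (lookup U i)))))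

isNonzero-true : ∀ x → x ≢ + 0 → isNonzero x ≡ true
isNonzero-true x ne with x ≟ + 0
... | yes e = ⊥-elim (ne e)
... | no _ = refl

if-suc-≥ : ∀ b c → c N.≤ (if b then suc c else c)
if-suc-≥ true c = NP.n≤1+n c
if-suc-≥ false c = NP.≤-refl

countNonzero≥1 : ∀ {m} (r : Vec ℤ m) j → lookup r j ≢ + 0 → 1 N.≤ countNonzero r
countNonzero≥1 (x ∷ v) zero ne rewrite countNonzero-∷ x v | isNonzero-true x ne = s≤s z≤n
countNonzero≥1 (x ∷ v) (suc j) ne rewrite countNonzero-∷ x v = NP.≤-trans (countNonzero≥1 v j ne) (if-suc-≥ (isNonzero x) (countNonzero v))

tesler-nonzeroCount≥ : ∀ {n} {α : Vec ℤ n} (U : Matrix n) → IsTesler α U → n N.≤ nonzeroCount U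
tesler-nonzeroCount≥ {zero} U t = z≤n
tesler-nonzeroCount≥ {suc n} {a ∷ β} U t =
  subst (λ V → suc n N.≤ nonzeroCount V) (sym U≡) (subst (suc n N.≤_) (sym (nonzeroCount-addTopRow r U′))
    (NP.+-mono-≤ (countNonzero≥1 r j r[j]≢0) (tesler-nonzeroCount≥ U′ (tesler-addTopRow⇒sub t′))))
  where
  r = V.head U
  U′ = subMatrix U
  U≡ : U ≡ addTopRow r U′
  U≡ = tesler≡addTopRow U t
  t′ : IsTesler (a ∷ β) (addTopRow r U′)
  t′ = subst (IsTesler (a ∷ β)) U≡ t
  j : Fin (suc n)
  j = proj₁ (IsTeslerRow.nonzero (tesler-addTopRow⇒row t′))
  r[j]≢0 : lookup r j ≢ + 0
  r[j]≢0 = proj₂ (IsTeslerRow.nonzero (tesler-addTopRow⇒row t′))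

countNonzero≡0⇒positive : ∀ {m} (v : Vec ℤ m) → countNonzero v ≡ 0 → (countPositive v ≡ 0) × (allPositive v ≡ true)
countNonzero≡0⇒positive [] e = refl , refl
countNonzero≡0⇒positive (x ∷ v) e with x ≟ + 0 | countNonzero-∷ x v | countPositive-∷ x v | allPositive-∷ x v
... | yes refl | e1 | e2 | e3 = let (a , b) = countNonzero≡0⇒positive v (trans (sym e1) e) in trans e2 a , trans e3 b
... | no _ | e1 | _ | _ with trans (sym e1) e
... | ()

countNonzero≡0⇒zeros : ∀ {m} (v : Vec ℤ m) → countNonzero v ≡ 0 → v ≡ V.replicate m (+ 0)
countNonzero≡0⇒zeros [] e = refl
countNonzero≡0⇒zeros (x ∷ v) e with x ≟ + 0 | countNonzero-∷ x v
... | yes refl | e1 = cong (+ 0 ∷_) (countNonzero≡0⇒zeros v (trans (sym e1) e))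
... | no _ | e1 with trans (sym e1) e
... | ()

if-positive : ∀ (b : Bool) → (if b then 1 else 0) ≡ (if (false ∨ b) ∧ true then 1 else 0)
if-positive true = refl
if-positive false = refl

countNonzero≡1⇒countPositive : ∀ {m} (v : Vec ℤ m) → countNonzero v ≡ 1 → countPositive v ≡ (if allPositive v then 1 else 0)
countNonzero≡1⇒countPositive (x ∷ v) e with x ≟ + 0 | countNonzero-∷ x v | countPositive-∷ x v | allPositive-∷ x v
... | yes refl | e1 | e2 | e3 = trans e2 (trans (countNonzero≡1⇒countPositive v (trans (sym e1) e)) (cong (λ b → if b then 1 else 0) (sym e3)))
... | no _ | e1 | e2 | e3 = let (a , b) = countNonzero≡0⇒positive v (NP.suc-injective (trans (sym e1) e)) in
  trans e2 (trans (cong (λ c → if isPositive x then suc c else c) a)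
   (trans (if-positive (isPositive x)) (cong (λ c → if c then 1 else 0) (sym (trans e3 (cong (λ c → (false ∨ isPositive x) ∧ c) b))))))

-- Tesler matrices have nonzero U ≥ n, and at q = t = 1 the factor M^(nonzero U - n) kills all
-- matrices with more than one nonzero entry in some row.
Sparse : ∀ {n} → Matrix n → Set
Sparse {n} U = nonzeroCount U N.≤ n

sparse-addTopRow : ∀ {n} (r : Vec ℤ (suc n)) (U : Matrix n) → 1 N.≤ countNonzero r → n N.≤ nonzeroCount U →
  nonzeroCount (addTopRow r U) N.≤ suc n → (countNonzero r ≡ 1) × (nonzeroCount U N.≤ n)
sparse-addTopRow {n} r U c1 cn le = NP.≤-antisym c≤1 c1 , u≤
  where
  le' : countNonzero r N.+ nonzeroCount U N.≤ 1 N.+ n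
  le' = subst (N._≤ suc n) (nonzeroCount-addTopRow r U) le
  c≤1 : countNonzero r N.≤ 1
  c≤1 = NP.+-cancelʳ-≤ n (countNonzero r) 1 (NP.≤-trans (NP.+-monoʳ-≤ (countNonzero r) cn) le')
  u≤ : nonzeroCount U N.≤ n
  u≤ = NP.+-cancelˡ-≤ 1 (nonzeroCount U) n (NP.≤-trans (NP.+-monoˡ-≤ (nonzeroCount U) c1) le')

sparse⇒entriesPos≡rowsPos : ∀ {n} {α : Vec ℤ n} (U : Matrix n) → IsTesler α U → Sparse U → entriesPos U ≡ rowsPos U
sparse⇒entriesPos≡rowsPos {zero} (U) t f = refl
sparse⇒entriesPos≡rowsPos {suc n} {a ∷ β} U t s =
  subst (λ V → entriesPos V ≡ rowsPos V) (sym U≡) (begin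
    entriesPos (addTopRow r U′)                      ≡⟨ entriesPos-addTopRow r U′ ⟩
    countPositive r N.+ entriesPos U′                 ≡⟨ cong₂ N._+_ (countNonzero≡1⇒countPositive r (proj₁ split))
                                                                    (sparse⇒entriesPos≡rowsPos U′ t′′ (proj₂ split)) ⟩
    (if allPositive r then 1 else 0) N.+ rowsPos U′  ≡⟨ if-one+ (allPositive r) (rowsPos U′) ⟩
    (if allPositive r then suc (rowsPos U′) else rowsPos U′) ≡⟨ rowsPos-addTopRow r U′ ⟨
    rowsPos (addTopRow r U′)                         ∎)
  where
  open ≡-Reasoning
  r = V.head U
  U′ = subMatrix U
  U≡ : U ≡ addTopRow r U′
  U≡ = tesler≡addTopRow U t
  t′ : IsTesler (a ∷ β) (addTopRow r U′)
  t′ = subst (IsTesler (a ∷ β)) U≡ t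
  t′′ : IsTesler (subHooks β r) U′
  t′′ = tesler-addTopRow⇒sub t′
  split : (countNonzero r ≡ 1) × Sparse U′
  split = sparse-addTopRow r U′
    (let (j , ne) = IsTeslerRow.nonzero (tesler-addTopRow⇒row t′) in countNonzero≥1 r j ne)
    (tesler-nonzeroCount≥ U′ t′′) (subst Sparse U≡ s)
  if-one+ : ∀ b c → (if b then 1 else 0) N.+ c ≡ (if b then suc c else c)
  if-one+ true c = refl
  if-one+ false c = refl

wt₁₁-sparse : ∀ {n} {α : Vec ℤ n} (U : Matrix n) → IsTesler α U → Sparse U → wt₁₁ U ≡ prodNonzeroᴹ U
wt₁₁-sparse {n} U t f rewrite sparse⇒entriesPos≡rowsPos U t f | NP.n∸n≡0 (rowsPos U) | NP.m≤n⇒m∸n≡0 f = ℤP.*-identityˡ (prodNonzeroᴹ U)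

wt₁₁-nonSparse : ∀ {n} (U : Matrix n) → n N.< nonzeroCount U → wt₁₁ U ≡ + 0
wt₁₁-nonSparse {n} U lt with nonzeroCount U N.∸ n | NP.m>n⇒m∸n≢0 lt
... | zero | ne = ⊥-elim (ne refl)
... | suc k | _ = trans (cong (_* prodNonzeroᴹ U) (ℤP.*-zeroʳ (negOnePow (entriesPos U N.∸ rowsPos U)))) (ℤP.*-zeroˡ (prodNonzeroᴹ U))

unitRow : ∀ {m} → Fin m → ℤ → Vec ℤ m
unitRow {suc m} zero a = a ∷ V.replicate m (+ 0)
unitRow (suc k) a = + 0 ∷ unitRow k a

countNonzero-zeros : ∀ m → countNonzero (V.replicate m (+ 0)) ≡ 0
countNonzero-zeros zero = refl
countNonzero-zeros (suc m) = trans (countNonzero-∷ (+ 0) (V.replicate m (+ 0))) (countNonzero-zeros m)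

unitRow-of-countNonzero≤1 : ∀ {m} (r : Vec ℤ m) j → countNonzero r N.≤ 1 → lookup r j ≢ + 0 → r ≡ unitRow j (lookup r j)
unitRow-of-countNonzero≤1 (x ∷ v) zero le ne rewrite countNonzero-∷ x v | isNonzero-true x ne = cong (x ∷_) (countNonzero≡0⇒zeros v (NP.n≤0⇒n≡0 (NP.≤-pred le)))
unitRow-of-countNonzero≤1 (x ∷ v) (suc j) le ne with x ≟ + 0 | countNonzero-∷ x v
... | yes refl | e1 = cong (+ 0 ∷_) (unitRow-of-countNonzero≤1 v j (subst (N._≤ 1) e1 le) ne)
... | no _ | e1 = ⊥-elim (no10 (NP.≤-trans (countNonzero≥1 v j ne) (NP.≤-pred (subst (N._≤ 1) e1 le))))
  where no10 : 1 N.≤ 0 → ⊥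
        no10 ()

rowSum-zeros : ∀ m → rowSum (V.replicate m (+ 0)) ≡ + 0
rowSum-zeros zero = refl
rowSum-zeros (suc m) = trans (Σᶠ-suc (lookup (V.replicate (suc m) (+ 0)))) (trans (ℤP.+-identityˡ _) (rowSum-zeros m))

rowSum-unitRow : ∀ {m} (k : Fin m) a → rowSum (unitRow k a) ≡ a
rowSum-unitRow {suc m} zero a = trans (Σᶠ-suc (lookup (unitRow {suc m} zero a))) (trans (cong (λ e → a + e) (rowSum-zeros m)) (ℤP.+-identityʳ a))
rowSum-unitRow (suc k) a = trans (Σᶠ-suc (lookup (unitRow (suc k) a))) (trans (ℤP.+-identityˡ _) (rowSum-unitRow k a))

countNonzero-unitRow : ∀ {m} (k : Fin m) a → a ≢ + 0 → countNonzero (unitRow k a) ≡ 1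
countNonzero-unitRow {suc m} zero a ne rewrite countNonzero-∷ a (V.replicate m (+ 0)) | isNonzero-true a ne = cong suc (countNonzero-zeros m)
countNonzero-unitRow (suc k) a ne = trans (countNonzero-∷ (+ 0) (unitRow k a)) (countNonzero-unitRow k a ne)

prodNonzero-zeros : ∀ m → prodNonzero (V.replicate m (+ 0)) ≡ + 1
prodNonzero-zeros zero = refl
prodNonzero-zeros (suc m) = trans (prodNonzero-0∷ (V.replicate m (+ 0))) (prodNonzero-zeros m)

prodNonzero-unitRow : ∀ {m} (k : Fin m) a → a ≢ + 0 → prodNonzero (unitRow k a) ≡ a
prodNonzero-unitRow {suc m} zero a ne = trans (prodNonzero-∷ a (V.replicate m (+ 0)))
  (trans (cong₂ _*_ (cong (λ b → if b then a else + 1) (isNonzero-true a ne)) (prodNonzero-zeros m)) (ℤP.*-identityʳ a))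
prodNonzero-unitRow (suc k) a ne = trans (prodNonzero-0∷ (unitRow k a)) (prodNonzero-unitRow k a ne)

lookup-unitRow : ∀ {m} (k : Fin m) a j → (lookup (unitRow k a) j ≡ a) ⊎ (lookup (unitRow k a) j ≡ + 0)
lookup-unitRow zero a zero = inj₁ refl
lookup-unitRow zero a (suc j) = inj₂ (lookup-replicate j (+ 0))
lookup-unitRow (suc k) a zero = inj₂ refl
lookup-unitRow (suc k) a (suc j) = lookup-unitRow k a j

lookup-unitRow-at : ∀ {m} (k : Fin m) a → lookup (unitRow k a) k ≡ a
lookup-unitRow-at zero a = refl
lookup-unitRow-at (suc k) a = lookup-unitRow-at k a

unitRow-teslerRow : ∀ {n} (k : Fin (suc n)) a → a ≢ + 0 → IsTeslerRow a (unitRow k a)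
unitRow-teslerRow k a ne = record
  { signed = signed
  ; nonzero = k , (λ e → ne (trans (sym (lookup-unitRow-at k a)) e))
  ; rowSum≡ = rowSum-unitRow k a
  }
  where
  signed : (∀ j → + 0 ≤ℤ lookup (unitRow k a) j) ⊎ (∀ j → lookup (unitRow k a) j ≤ℤ + 0)
  signed with ℤP.≤-total (+ 0) a
  ... | inj₁ 0≤a = inj₁ (λ j → Sum.[ (λ e → subst (+ 0 ≤ℤ_) (sym e) 0≤a) , (λ e → subst (+ 0 ≤ℤ_) (sym e) ℤP.≤-refl) ]′
                                      (lookup-unitRow k a j))
  ... | inj₂ a≤0 = inj₂ (λ j → Sum.[ (λ e → subst (_≤ℤ + 0) (sym e) a≤0) , (λ e → subst (_≤ℤ + 0) (sym e) ℤP.≤-refl) ]′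
                                      (lookup-unitRow k a j))

unitRow-injective : ∀ {m} (k k' : Fin m) a → a ≢ + 0 → unitRow k a ≡ unitRow k' a → k ≡ k'
unitRow-injective zero zero a ne e = refl
unitRow-injective zero (suc k') a ne e = ⊥-elim (ne (cong V.head e))
unitRow-injective (suc k) zero a ne e = ⊥-elim (ne (sym (cong V.head e)))
unitRow-injective (suc k) (suc k') a ne e = cong suc (unitRow-injective k k' a ne (cong V.tail e))

zipWith-+-zeros : ∀ {n} (β : Vec ℤ n) → zipWith _+_ β (V.replicate n (+ 0)) ≡ β
zipWith-+-zeros [] = refl
zipWith-+-zeros (b ∷ β) = cong₂ _∷_ (ℤP.+-identityʳ b) (zipWith-+-zeros β)

zipWith-+-unitRow : ∀ {n} (β : Vec ℤ n) j a → zipWith _+_ β (unitRow j a) ≡ addAt j a β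
zipWith-+-unitRow (b ∷ β) zero a = cong ((b + a) ∷_) (zipWith-+-zeros β)
zipWith-+-unitRow (b ∷ β) (suc j) a = cong₂ _∷_ (ℤP.+-identityʳ b) (zipWith-+-unitRow β j a)

subHooks-unitRow-zero : ∀ {n} (β : Vec ℤ n) a → subHooks β (unitRow zero a) ≡ β
subHooks-unitRow-zero β a = zipWith-+-zeros β

subHooks-unitRow-suc : ∀ {n} (β : Vec ℤ n) j a → subHooks β (unitRow (suc j) a) ≡ addAt j a β
subHooks-unitRow-suc β j a = zipWith-+-unitRow β j a

mutual
  sparseTeslers : ∀ n → Vec ℤ n → List (Matrix n)
  sparseTeslers zero [] = [] ∷ []
  sparseTeslers (suc n) (a ∷ β) = sparseTeslersFrom n a β (a ≟ + 0)

  sparseTeslersFrom : ∀ n (a : ℤ) (β : Vec ℤ n) → Dec (a ≡ + 0) → List (Matrix (suc n))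
  sparseTeslersFrom n a β (yes _) = []
  sparseTeslersFrom n a β (no _) = concatᶠ (λ (k : Fin (suc n)) → map (addTopRow (unitRow k a)) (sparseTeslers n (subHooks β (unitRow k a))))

SparseTesler : ∀ {n} → Vec ℤ n → Matrix n → Set
SparseTesler α U = IsTesler α U × Sparse U

sparseTesler-addTopRow : ∀ {n} {a} {β : Vec ℤ n} k U' → a ≢ + 0 →
  SparseTesler (subHooks β (unitRow k a)) U' → SparseTesler (a ∷ β) (addTopRow (unitRow k a) U')
sparseTesler-addTopRow {n} {a} {β} k U' ne (t , f) = tesler-addTopRow⇐ (unitRow-teslerRow k a ne) t ,
  subst (N._≤ suc n) (sym (trans (nonzeroCount-addTopRow (unitRow k a) U') (cong (N._+ nonzeroCount U') (countNonzero-unitRow k a ne)))) (s≤s f)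

enum-sparseTeslers : ∀ n (α : Vec ℤ n) → Enumerates (SparseTesler α) (sparseTeslers n α)
enum-sparseTeslers zero [] = ([] ∷ []) , (λ { [] (here refl) → tesler-empty , z≤n }) , λ { [] _ → here refl }
enum-sparseTeslers (suc n) (a ∷ β) with a ≟ + 0
... | yes refl = enum-empty λ U (t , f) → no-teslerRow-zero (V.head U) (tesler-addTopRow⇒row (subst (IsTesler (+ 0 ∷ β)) (tesler≡addTopRow U t) t))
... | no ne = enum-concatᶠ
  (λ k U → ∃ λ U′ → SparseTesler (subHooks β (unitRow k a)) U′ × addTopRow (unitRow k a) U′ ≡ U)
  (λ k → map (addTopRow (unitRow k a)) (sparseTeslers n (subHooks β (unitRow k a))))
  (λ k → enum-map (addTopRow (unitRow k a)) (λ e → proj₂ (addTopRow-injective e)) (enum-sparseTeslers n (subHooks β (unitRow k a)))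
           (λ U′ tf → U′ , tf , refl) (λ U (U′ , tf , e) → U′ , tf , e))
  (λ U k k' (U1 , _ , e1) (U2 , _ , e2) → unitRow-injective k k' a ne (proj₁ (addTopRow-injective (trans e1 (sym e2)))))
  first-row-is-unit
  (λ { U k (U′ , tf , refl) → sparseTesler-addTopRow k U′ ne tf })
  where
  first-row-is-unit : ∀ U → SparseTesler (a ∷ β) U → ∃ λ k → ∃ λ U′ → SparseTesler (subHooks β (unitRow k a)) U′ × addTopRow (unitRow k a) U′ ≡ U
  first-row-is-unit U (t , f) = j , U′ , subst (λ r → SparseTesler (subHooks β r) U′) r≡a·eⱼ (tU′ , proj₂ sparse-split) ,
                 trans (cong (λ r → addTopRow r U′) (sym r≡a·eⱼ)) (sym (tesler≡addTopRow U t))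
    where
    r = V.head U
    U′ = subMatrix U
    tU : IsTesler (a ∷ β) (addTopRow r U′)
    tU = subst (IsTesler (a ∷ β)) (tesler≡addTopRow U t) t
    tU′ : IsTesler (subHooks β r) U′
    tU′ = tesler-addTopRow⇒sub tU
    rw : IsTeslerRow a r
    rw = tesler-addTopRow⇒row tU
    j : Fin (suc n)
    j = proj₁ (IsTeslerRow.nonzero rw)
    sparse-split : (countNonzero r ≡ 1) × Sparse U′
    sparse-split = sparse-addTopRow r U′ (countNonzero≥1 r j (proj₂ (IsTeslerRow.nonzero rw))) (tesler-nonzeroCount≥ U′ tU′)
      (subst Sparse (tesler≡addTopRow U t) f)
    r≡unitRow : r ≡ unitRow j (lookup r j)
    r≡unitRow = unitRow-of-countNonzero≤1 r j (NP.≤-reflexive (proj₁ sparse-split)) (proj₂ (IsTeslerRow.nonzero rw))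
    r≡a·eⱼ : r ≡ unitRow j a
    r≡a·eⱼ = trans r≡unitRow (cong (unitRow j) (trans (sym (rowSum-unitRow j (lookup r j))) (trans (cong rowSum (sym r≡unitRow)) (IsTeslerRow.rowSum≡ rw))))

sum-sparseTeslers : ∀ n (α : Vec ℤ n) → sumℤ (map wt₁₁ (sparseTeslers n α)) ≡ tesRec n α
sum-sparseTeslers zero [] = refl
sum-sparseTeslers (suc n) (a ∷ β) with a ≟ + 0
... | yes refl = sym (ℤP.*-zeroˡ (tesRec n β + Σᶠ (λ j → tesRec n (addAt j (+ 0) β))))
... | no a≢0 = begin
  sumℤ (map wt₁₁ (concatᶠ (λ k → map (addTopRow (e k)) (Us k))))
    ≡⟨ sum-concatᶠ wt₁₁ (λ k → map (addTopRow (e k)) (Us k)) ⟩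
  Σᶠ (λ k → sumℤ (map wt₁₁ (map (addTopRow (e k)) (Us k))))
    ≡⟨ Σᶠ-cong (λ k → sum-map-* wt₁₁ (addTopRow (e k)) a wt₁₁ (Us k) (λ U U∈ → wt₁₁-addTopRow k U (sound k U∈))) ⟩
  Σᶠ (λ k → a * sumℤ (map wt₁₁ (Us k)))
    ≡⟨ Σᶠ-cong (λ k → cong (a *_) (sum-sparseTeslers n (subHooks β (e k)))) ⟩
  Σᶠ (λ k → a * tesRec n (subHooks β (e k)))
    ≡⟨ Σᶠ-*ˡ a (λ k → tesRec n (subHooks β (e k))) ⟩
  a * Σᶠ (λ k → tesRec n (subHooks β (e k)))
    ≡⟨ cong (a *_) (Σᶠ-suc (λ k → tesRec n (subHooks β (e k)))) ⟩
  a * (tesRec n (subHooks β (e zero)) + Σᶠ (λ j → tesRec n (subHooks β (e (suc j)))))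
    ≡⟨ cong (a *_) (cong₂ _+_ (cong (tesRec n) (subHooks-unitRow-zero β a))
                               (Σᶠ-cong (λ j → cong (tesRec n) (subHooks-unitRow-suc β j a)))) ⟩
  a * (tesRec n β + Σᶠ (λ j → tesRec n (addAt j a β)))
    ∎
  where
  open ≡-Reasoning
  e : Fin (suc n) → Vec ℤ (suc n)
  e k = unitRow k a
  Us : Fin (suc n) → List (Matrix n)
  Us k = sparseTeslers n (subHooks β (e k))
  sound : ∀ k {U} → U ∈ Us k → SparseTesler (subHooks β (e k)) U
  sound k {U} = proj₁ (proj₂ (enum-sparseTeslers n _)) U
  wt₁₁-addTopRow : ∀ k U → SparseTesler (subHooks β (e k)) U → wt₁₁ (addTopRow (e k) U) ≡ a * wt₁₁ U
  wt₁₁-addTopRow k U (t , s) = let (t′ , s′) = sparseTesler-addTopRow k U a≢0 (t , s) in begin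
    wt₁₁ (addTopRow (e k) U)                  ≡⟨ wt₁₁-sparse _ t′ s′ ⟩
    prodNonzeroᴹ (addTopRow (e k) U)          ≡⟨ prodNonzeroᴹ-addTopRow (e k) U ⟩
    prodNonzero (e k) * prodNonzeroᴹ U         ≡⟨ cong (_* prodNonzeroᴹ U) (prodNonzero-unitRow k a a≢0) ⟩
    a * prodNonzeroᴹ U                        ≡⟨ cong (a *_) (wt₁₁-sparse U t s) ⟨
    a * wt₁₁ U                                ∎

sum-wt₁₁≡tesRec : ∀ n (α : Vec ℤ n) L → Enumerates (IsTesler α) L → sumℤ (map wt₁₁ L) ≡ tesRec n α
sum-wt₁₁≡tesRec n α L e =
  trans (sum-filter Sparse? wt₁₁ L (λ U _ nf → wt₁₁-nonSparse U (NP.≰⇒> nf)))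
  (trans (enum-sum-unique wt₁₁ (enum-filter Sparse? e (λ U tf → tf) (λ U t f → t , f)) (enum-sparseTeslers n α)) (sum-sparseTeslers n α))
  where
  Sparse? : (U : Matrix n) → Dec (Sparse U)
  Sparse? U = nonzeroCount U N.≤? n

true≢false : true ≢ false
true≢false ()

≢true⇒false : ∀ {b} → b ≢ true → b ≡ false
≢true⇒false {false} _ = refl
≢true⇒false {true} b≢true = ⊥-elim (b≢true refl)

Bool-ext : ∀ {b c : Bool} → (b ≡ true → c ≡ true) → (c ≡ true → b ≡ true) → b ≡ c
Bool-ext {false} {false} _ _ = refl
Bool-ext {false} {true}  _ g = g refl
Bool-ext {true}          f _ = sym (f refl)

≤ᵇ-true : ∀ {m r} → m ≤ r → (m ≤ᵇ r) ≡ true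
≤ᵇ-true m≤r = Equivalence.to T-≡ (NP.≤⇒≤ᵇ m≤r)

≤ᵇ-true⇒ : ∀ m r → (m ≤ᵇ r) ≡ true → m ≤ r
≤ᵇ-true⇒ m r e = NP.≤ᵇ⇒≤ m r (Equivalence.from T-≡ e)

≤ᵇ-false : ∀ {m r} → r < m → (m ≤ᵇ r) ≡ false
≤ᵇ-false {m} {r} r<m = ≢true⇒false (λ e → NP.<⇒≱ r<m (≤ᵇ-true⇒ m r e))

≡ᵇ-refl : ∀ x → (x ≡ᵇ x) ≡ true
≡ᵇ-refl x = Equivalence.to T-≡ (NP.≡⇒≡ᵇ x x refl)

≡ᵇ-true⇒ : ∀ {x y} → (x ≡ᵇ y) ≡ true → x ≡ y
≡ᵇ-true⇒ {x} {y} e = NP.≡ᵇ⇒≡ x y (Equivalence.from T-≡ e)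

≡ᵇ-false : ∀ {x y} → x ≢ y → (x ≡ᵇ y) ≡ false
≡ᵇ-false x≢y = ≢true⇒false (λ e → x≢y (≡ᵇ-true⇒ e))

≡ᵇ-sym : ∀ x y → (x ≡ᵇ y) ≡ (y ≡ᵇ x)
≡ᵇ-sym zero zero = refl
≡ᵇ-sym zero (suc y) = refl
≡ᵇ-sym (suc x) zero = refl
≡ᵇ-sym (suc x) (suc y) = ≡ᵇ-sym x y

-- punchIn q is the increasing bijection ℕ → ℕ ∖ {q} (the ℕ analogue of Data.Fin.punchIn).
punchIn : ℕ → ℕ → ℕ
punchIn zero x = suc x
punchIn (suc q) zero = zero
punchIn (suc q) (suc x) = suc (punchIn q x)

punchIn-< : ∀ q x → x < q → punchIn q x ≡ x
punchIn-< (suc q) zero lt = refl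
punchIn-< (suc q) (suc x) (s≤s lt) = cong suc (punchIn-< q x lt)

punchIn-≥ : ∀ q x → q ≤ x → punchIn q x ≡ suc x
punchIn-≥ zero x le = refl
punchIn-≥ (suc q) (suc x) (s≤s le) = cong suc (punchIn-≥ q x le)

punchIn-≢ : ∀ q x → punchIn q x ≢ q
punchIn-≢ zero x ()
punchIn-≢ (suc q) zero ()
punchIn-≢ (suc q) (suc x) e = punchIn-≢ q x (NP.suc-injective e)

punchIn-injective : ∀ q {x y} → punchIn q x ≡ punchIn q y → x ≡ y
punchIn-injective zero e = NP.suc-injective e
punchIn-injective (suc q) {zero} {zero} e = refl
punchIn-injective (suc q) {suc x} {suc y} e = cong suc (punchIn-injective q (NP.suc-injective e))

punchIn-mono-≤ : ∀ q {x y} → x ≤ y → punchIn q x ≤ punchIn q y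
punchIn-mono-≤ zero le = s≤s le
punchIn-mono-≤ (suc q) {zero} le = z≤n
punchIn-mono-≤ (suc q) {suc x} {suc y} (s≤s le) = s≤s (punchIn-mono-≤ q le)

punchIn-cancel-≤ : ∀ q {x y} → punchIn q x ≤ punchIn q y → x ≤ y
punchIn-cancel-≤ zero (s≤s le) = le
punchIn-cancel-≤ (suc q) {zero} le = z≤n
punchIn-cancel-≤ (suc q) {suc x} {zero} ()
punchIn-cancel-≤ (suc q) {suc x} {suc y} (s≤s le) = s≤s (punchIn-cancel-≤ q le)

punchIn-suc≤punchIn : ∀ q r → punchIn (suc q) r ≤ punchIn q r
punchIn-suc≤punchIn zero zero = z≤n
punchIn-suc≤punchIn zero (suc r) = NP.≤-refl
punchIn-suc≤punchIn (suc q) zero = z≤n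
punchIn-suc≤punchIn (suc q) (suc r) = s≤s (punchIn-suc≤punchIn q r)

punchIn<punchIn-suc : ∀ q {r m} → r < m → punchIn q r < punchIn (suc q) m
punchIn<punchIn-suc zero {r} {suc m} (s≤s lt) = s≤s (s≤s lt)
punchIn<punchIn-suc (suc q) {zero} {suc m} lt = s≤s z≤n
punchIn<punchIn-suc (suc q) {suc r} {suc m} (s≤s lt) = s≤s (punchIn<punchIn-suc q lt)

≤punchIn : ∀ q x → x ≤ punchIn q x
≤punchIn zero x = NP.n≤1+n x
≤punchIn (suc q) zero = z≤n
≤punchIn (suc q) (suc x) = s≤s (≤punchIn q x)

punchIn≤suc : ∀ q x → punchIn q x ≤ suc x
punchIn≤suc zero x = NP.≤-refl
punchIn≤suc (suc q) zero = z≤n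
punchIn≤suc (suc q) (suc x) = s≤s (punchIn≤suc q x)

punchOut : ℕ → ℕ → ℕ
punchOut zero zero = zero
punchOut zero (suc x) = x
punchOut (suc q) zero = zero
punchOut (suc q) (suc x) = suc (punchOut q x)

punchOut-punchIn : ∀ q x → punchOut q (punchIn q x) ≡ x
punchOut-punchIn zero x = refl
punchOut-punchIn (suc q) zero = refl
punchOut-punchIn (suc q) (suc x) = cong suc (punchOut-punchIn q x)

punchIn-punchOut : ∀ q x → x ≢ q → punchIn q (punchOut q x) ≡ x
punchIn-punchOut zero zero ne = ⊥-elim (ne refl)
punchIn-punchOut zero (suc x) ne = refl
punchIn-punchOut (suc q) zero ne = refl
punchIn-punchOut (suc q) (suc x) ne = cong suc (punchIn-punchOut q x (λ e → ne (cong suc e)))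

punchIn-cancel-< : ∀ q {x y} → punchIn q x < punchIn q y → x < y
punchIn-cancel-< q {x} {y} lt with x N.<? y
... | yes p = p
... | no np = ⊥-elim (NP.<⇒≱ lt (punchIn-mono-≤ q (NP.≮⇒≥ np)))

punchIn-mono-< : ∀ q {x y} → x < y → punchIn q x < punchIn q y
punchIn-mono-< q {x} {y} lt with punchIn q x N.<? punchIn q y
... | yes p = p
... | no np = ⊥-elim (NP.<⇒≱ lt (punchIn-cancel-≤ q (NP.≮⇒≥ np)))

≡ᵇ-punchIn : ∀ q x r → (punchIn q x ≡ᵇ punchIn q r) ≡ (x ≡ᵇ r)
≡ᵇ-punchIn zero x r = refl
≡ᵇ-punchIn (suc q) zero zero = refl
≡ᵇ-punchIn (suc q) zero (suc r) = refl
≡ᵇ-punchIn (suc q) (suc x) zero = refl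
≡ᵇ-punchIn (suc q) (suc x) (suc r) = ≡ᵇ-punchIn q x r

≡ᵇ-punchIn-self : ∀ q x → (punchIn q x ≡ᵇ q) ≡ false
≡ᵇ-punchIn-self q x = ≡ᵇ-false (punchIn-≢ q x)

map-punchIn-injective : ∀ {n} q {b1 b2 : Vec ℕ n} → V.map (punchIn q) b1 ≡ V.map (punchIn q) b2 → b1 ≡ b2
map-punchIn-injective q {[]} {[]} e = refl
map-punchIn-injective q {x ∷ b1} {y ∷ b2} e = cong₂ _∷_ (punchIn-injective q (cong V.head e)) (map-punchIn-injective q (cong V.tail e))

map-punchIn-above : ∀ {n} (b : Vec ℕ n) c → (∀ t → lookup b t < c) → V.map (punchIn c) b ≡ b
map-punchIn-above [] c h = refl
map-punchIn-above (x ∷ b) c h = cong₂ _∷_ (punchIn-< c x (h zero)) (map-punchIn-above b c (λ t → h (suc t)))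

map-punchIn-punchOut : ∀ {n} (b : Vec ℕ n) c → (∀ t → lookup b t ≢ c) → V.map (punchIn c) (V.map (punchOut c) b) ≡ b
map-punchIn-punchOut [] c h = refl
map-punchIn-punchOut (x ∷ b) c h = cong₂ _∷_ (punchIn-punchOut c x (h zero)) (map-punchIn-punchOut b c (λ t → h (suc t)))

sumN : ℕ → (ℕ → ℤ) → ℤ
sumN zero g = + 0
sumN (suc N) g = g 0 + sumN N (λ r → g (suc r))

sumN-cong : ∀ N {g g' : ℕ → ℤ} → (∀ r → r < N → g r ≡ g' r) → sumN N g ≡ sumN N g'
sumN-cong zero e = refl
sumN-cong (suc N) e = cong₂ _+_ (e 0 (s≤s z≤n)) (sumN-cong N (λ r lt → e (suc r) (s≤s lt)))

sumN-zero : ∀ N (g : ℕ → ℤ) → (∀ r → r < N → g r ≡ + 0) → sumN N g ≡ + 0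
sumN-zero zero g e = refl
sumN-zero (suc N) g e = cong₂ _+_ (e 0 (s≤s z≤n)) (sumN-zero N _ (λ r lt → e (suc r) (s≤s lt)))

sumN-+ : ∀ N (f g : ℕ → ℤ) → sumN N (λ r → f r + g r) ≡ sumN N f + sumN N g
sumN-+ zero f g = refl
sumN-+ (suc N) f g = trans (cong (λ e → f 0 + g 0 + e) (sumN-+ N (λ r → f (suc r)) (λ r → g (suc r))))
  (interchange (f 0) (g 0) (sumN N (λ r → f (suc r))) (sumN N (λ r → g (suc r))))
  where interchange : ∀ a b c d → a + b + (c + d) ≡ a + c + (b + d)
        interchange = solve-∀

sumN-leadingZeros : ∀ m K (g : ℕ → ℤ) → (∀ r → r < m → g r ≡ + 0) → sumN (m N.+ K) g ≡ sumN K (λ r → g (m N.+ r))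
sumN-leadingZeros zero K g e = refl
sumN-leadingZeros (suc m) K g e = trans (cong₂ _+_ (e 0 (s≤s z≤n)) (sumN-leadingZeros m K (λ r → g (suc r)) (λ r lt → e (suc r) (s≤s lt))))
  (ℤP.+-identityˡ _)

sumN-trailingZeros : ∀ K L (g : ℕ → ℤ) → (∀ r → K ≤ r → g r ≡ + 0) → sumN (K N.+ L) g ≡ sumN K g
sumN-trailingZeros zero L g e = sumN-zero L g (λ r _ → e r z≤n)
sumN-trailingZeros (suc K) L g e = cong (λ x → g 0 + x) (sumN-trailingZeros K L (λ r → g (suc r)) (λ r le → e (suc r) (s≤s le)))

sumN-punchIn : ∀ N q (g : ℕ → ℤ) → q ≤ N → sumN (suc N) g ≡ g q + sumN N (λ r → g (punchIn q r))
sumN-punchIn N zero g le = refl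
sumN-punchIn (suc N) (suc q) g (s≤s le) =
  trans (cong (λ e → g 0 + e) (sumN-punchIn N q (λ r → g (suc r)) le))
  (exchange (g 0) (g (suc q)) (sumN N (λ r → g (suc (punchIn q r)))))
  where exchange : ∀ a b c → a + (b + c) ≡ b + (a + c)
        exchange = solve-∀

sumN-indicator : ∀ N q (c : ℤ) → q < N → sumN N (λ r → if r ≡ᵇ q then c else + 0) ≡ c
sumN-indicator (suc N) zero c lt = trans (cong (λ e → c + e) (sumN-zero N _ (λ r _ → refl))) (ℤP.+-identityʳ c)
sumN-indicator (suc N) (suc q) c (s≤s lt) = trans (ℤP.+-identityˡ _) (sumN-indicator N q c lt)

sumN-punchIn-point : ∀ N q (G H : ℕ → ℤ) c → q < N → G q ≡ c → (∀ r → G (punchIn q r) ≡ H r) →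
  sumN (suc N) G ≡ sumN N (λ r → H r + (if r ≡ᵇ q then c else + 0))
sumN-punchIn-point N q G H c q<N Gq≡c G∘punchIn≡H = begin
  sumN (suc N) G                                          ≡⟨ sumN-punchIn N q G (NP.<⇒≤ q<N) ⟩
  G q + sumN N (λ r → G (punchIn q r))                     ≡⟨ cong₂ _+_ Gq≡c (sumN-cong N (λ r _ → G∘punchIn≡H r)) ⟩
  c + sumN N H                                            ≡⟨ ℤP.+-comm c (sumN N H) ⟩
  sumN N H + c                                            ≡⟨ cong (λ e → sumN N H + e) (sumN-indicator N q c q<N) ⟨
  sumN N H + sumN N (λ r → if r ≡ᵇ q then c else + 0)      ≡⟨ sumN-+ N H _ ⟨
  sumN N (λ r → H r + (if r ≡ᵇ q then c else + 0))         ∎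
  where open ≡-Reasoning

sum-applyUpTo : ∀ k (F : ℕ → ℤ) (f : ℕ → ℕ) → sumℤ (map F (applyUpTo f k)) ≡ sumN k (λ r → F (f r))
sum-applyUpTo zero F f = refl
sum-applyUpTo (suc k) F f = cong (λ e → F (f 0) + e) (sum-applyUpTo k F (λ r → f (suc r)))

map-applyUpTo : ∀ {A B : Set} (g : A → B) k (f : ℕ → A) → map g (applyUpTo f k) ≡ applyUpTo (λ r → g (f r)) k
map-applyUpTo g zero f = refl
map-applyUpTo g (suc k) f = cong (g (f 0) ∷_) (map-applyUpTo g k (λ r → f (suc r)))

inRange : ℕ → ℕ → ℕ → Bool
inRange m x r = (m ≤ᵇ r) ∧ (r ≤ᵇ x)

sum-rangeℕ : ∀ (F : ℕ → ℤ) m x N → m ≤ x → x < N →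
  sumℤ (map F (rangeℕ m x)) ≡ sumN N (λ r → if inRange m x r then F r else + 0)
sum-rangeℕ F m x N le lt = begin
    sumℤ (map F (map (m N.+_) (upTo k)))
  ≡⟨ cong (λ l → sumℤ (map F l)) (map-applyUpTo (m N.+_) k (λ r → r)) ⟩
    sumℤ (map F (applyUpTo (m N.+_) k))
  ≡⟨ sum-applyUpTo k F (m N.+_) ⟩
    sumN k (λ r → F (m N.+ r))
  ≡⟨ sumN-cong k (λ r r<k → sym (cong (λ b → if b then F (m N.+ r) else + 0) (ind-in r r<k))) ⟩
    sumN k (λ r → g (m N.+ r))
  ≡⟨ sym (sumN-trailingZeros k L (λ r → g (m N.+ r)) (λ r k≤r → cong (λ b → if b then F (m N.+ r) else + 0) (ind-out r k≤r))) ⟩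
    sumN (k N.+ L) (λ r → g (m N.+ r))
  ≡⟨ sym (sumN-leadingZeros m (k N.+ L) g (λ r r<m → cong (λ b → if b then F r else + 0) (ind-lo r r<m))) ⟩
    sumN (m N.+ (k N.+ L)) g
  ≡⟨ cong (λ n → sumN n g) eN ⟩
    sumN N g
  ∎
  where
  open ≡-Reasoning
  k = suc x ∸ m
  L = N ∸ suc x
  g = λ r → if inRange m x r then F r else + 0
  mk : m N.+ k ≡ suc x
  mk = NP.m+[n∸m]≡n (NP.≤-trans le (NP.n≤1+n x))
  eN : m N.+ (k N.+ L) ≡ N
  eN = trans (sym (NP.+-assoc m k L)) (trans (cong (N._+ L) mk) (NP.m+[n∸m]≡n lt))
  ind-in : ∀ r → r < k → inRange m x (m N.+ r) ≡ true
  ind-in r r<k = cong₂ _∧_ (≤ᵇ-true (NP.m≤m+n m r)) (≤ᵇ-true (NP.≤-pred (subst (m N.+ r <_) mk (NP.+-monoʳ-< m r<k))))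
  ind-out : ∀ r → k ≤ r → inRange m x (m N.+ r) ≡ false
  ind-out r k≤r = trans (cong (_∧ ((m N.+ r) ≤ᵇ x)) (≤ᵇ-true (NP.m≤m+n m r)))
    (≤ᵇ-false (subst (_≤ m N.+ r) mk (NP.+-monoʳ-≤ m k≤r)))
  ind-lo : ∀ r → r < m → inRange m x r ≡ false
  ind-lo r r<m = cong (_∧ (r ≤ᵇ x)) (≤ᵇ-false r<m)

inRange-punchIn : ∀ q m x r → inRange (punchIn (suc q) m) (punchIn q x) (punchIn q r) ≡ inRange m x r
inRange-punchIn q m x r = cong₂ _∧_
  (Bool-ext (λ e → ≤ᵇ-true (dec (≤ᵇ-true⇒ (punchIn (suc q) m) (punchIn q r) e)))
           (λ e → ≤ᵇ-true (NP.≤-trans (punchIn-mono-≤ (suc q) (≤ᵇ-true⇒ m r e)) (punchIn-suc≤punchIn q r))))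
  (Bool-ext (λ e → ≤ᵇ-true (punchIn-cancel-≤ q (≤ᵇ-true⇒ (punchIn q r) (punchIn q x) e))) (λ e → ≤ᵇ-true (punchIn-mono-≤ q (≤ᵇ-true⇒ r x e))))
  where
  dec : punchIn (suc q) m ≤ punchIn q r → m ≤ r
  dec le with m N.≤? r
  ... | yes p = p
  ... | no np = ⊥-elim (NP.<⇒≱ (punchIn<punchIn-suc q (NP.≰⇒> np)) le)

inRange-punchIn-self : ∀ q m x → inRange (punchIn (suc q) m) (punchIn q x) q ≡ inRange m x q
inRange-punchIn-self q m x = cong₂ _∧_
  (Bool-ext (λ e → ≤ᵇ-true (NP.≤-trans (≤punchIn (suc q) m) (≤ᵇ-true⇒ (punchIn (suc q) m) q e)))
           (λ e → ≤ᵇ-true (NP.≤-trans (NP.≤-reflexive (punchIn-< (suc q) m (s≤s (≤ᵇ-true⇒ m q e)))) (≤ᵇ-true⇒ m q e))))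
  (Bool-ext (λ e → ≤ᵇ-true (dec (≤ᵇ-true⇒ q (punchIn q x) e))) (λ e → ≤ᵇ-true (NP.≤-trans (≤ᵇ-true⇒ q x e) (≤punchIn q x))))
  where
  dec : q ≤ punchIn q x → q ≤ x
  dec le with q N.≤? x
  ... | yes p = p
  ... | no np = ⊥-elim (NP.<⇒≱ (subst (_< q) (sym (punchIn-< q x (NP.≰⇒> np))) (NP.≰⇒> np)) le)

-- afterLast (hasLarger b i) is the paper's m_i(π) - 1, abstracted over the predicate.
afterLast : (ℕ → Bool) → ℕ → ℕ
afterLast h zero = zero
afterLast h (suc r) = if h r then suc r else afterLast h r

afterLast-≤ : ∀ h y → afterLast h y ≤ y
afterLast-≤ h zero = z≤n
afterLast-≤ h (suc r) with h r
... | true = NP.≤-refl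
... | false = NP.≤-trans (afterLast-≤ h r) (NP.n≤1+n r)

afterLast-cong : ∀ {h h'} → (∀ r → h r ≡ h' r) → ∀ y → afterLast h y ≡ afterLast h' y
afterLast-cong e zero = refl
afterLast-cong {h} {h'} e (suc r) rewrite e r with h' r
... | true = refl
... | false = afterLast-cong e r

afterLast-punchIn : ∀ q (h h' : ℕ → Bool) → (∀ r → h (punchIn q r) ≡ h' r) → h q ≡ false →
  ∀ y → afterLast h (punchIn q y) ≡ punchIn (suc q) (afterLast h' y)
afterLast-punchIn zero h h' e hq zero = trans (cong (λ b → if b then 1 else 0) hq) refl
afterLast-punchIn (suc q) h h' e hq zero = refl
afterLast-punchIn q h h' e hq (suc y) with NP.<-cmp (suc y) q
... | tri< lt _ _ =
  trans (cong (afterLast h) (punchIn-< q (suc y) lt))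
  (trans (cong (λ b → if b then suc y else afterLast h y) (trans (cong h (sym (punchIn-< q y (NP.<-trans (NP.n<1+n y) lt)))) (e y)))
   (case (h' y)))
  where
  case : ∀ b → (if b then suc y else afterLast h y) ≡ punchIn (suc q) (if b then suc y else afterLast h' y)
  case true = sym (punchIn-< (suc q) (suc y) (NP.<-trans lt (NP.n<1+n q)))
  case false = trans (cong (afterLast h) (sym (punchIn-< q y (NP.<-trans (NP.n<1+n y) lt)))) (afterLast-punchIn q h h' e hq y)
... | tri≈ _ refl _ =
  trans (cong (afterLast h) (punchIn-≥ (suc y) (suc y) NP.≤-refl))
  (trans (cong (λ b → if b then suc (suc y) else afterLast h (suc y)) hq)
  (trans (cong (λ b → if b then suc y else afterLast h y) (trans (cong h (sym (punchIn-< (suc y) y (NP.n<1+n y)))) (e y)))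
   (case (h' y))))
  where
  case : ∀ b → (if b then suc y else afterLast h y) ≡ punchIn (suc (suc y)) (if b then suc y else afterLast h' y)
  case true = sym (punchIn-< (suc (suc y)) (suc y) (NP.n<1+n (suc y)))
  case false = trans (cong (afterLast h) (sym (punchIn-< (suc y) y (NP.n<1+n y)))) (afterLast-punchIn (suc y) h h' e hq y)
... | tri> _ _ gt =
  trans (cong (afterLast h) (punchIn-≥ q (suc y) (NP.<⇒≤ gt)))
  (trans (cong (λ b → if b then suc (suc y) else afterLast h (suc y)) (trans (cong h (sym (punchIn-≥ q y (NP.≤-pred gt)))) (e y)))
   (case (h' y)))
  where
  case : ∀ b → (if b then suc (suc y) else afterLast h (suc y)) ≡ punchIn (suc q) (if b then suc y else afterLast h' y)
  case true = sym (punchIn-≥ (suc q) (suc y) gt)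
  case false = trans (cong (afterLast h) (sym (punchIn-≥ q y (NP.≤-pred gt)))) (afterLast-punchIn q h h' e hq y)

afterLast-all : ∀ h y → (∀ r → r < y → h r ≡ true) → afterLast h y ≡ y
afterLast-all h zero e = refl
afterLast-all h (suc y) e = cong (λ t → if t then suc y else afterLast h y) (e y NP.≤-refl)

-- IsOSP with set(α) replaced by an arbitrary set S of marked positions, since the
-- recursion changes α.
record IsMarkedOSP {n} (S : Vec Bool n) (b : Vec ℕ n) : Set where
  field
    blocksNonempty  : ∀ i r → r < lookup b i → ∃ λ j → lookup b j ≡ r
    minMarked : ∀ i → (∀ j → toℕ j < toℕ i → lookup b j ≢ lookup b i) → lookup S i ≡ true
    markedMin : ∀ i → lookup S i ≡ true → ∀ j → toℕ j < toℕ i → lookup b j ≢ lookup b i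

open IsMarkedOSP

anyᶠ-suc : ∀ {m} (p : Fin (suc m) → Bool) → anyᶠ p ≡ (p zero ∨ anyᶠ (λ i → p (suc i)))
anyᶠ-suc p = foldr-allFin-suc (λ i acc → p i ∨ acc) false

anyᶠ-cong : ∀ {m} {p q : Fin m → Bool} → (∀ i → p i ≡ q i) → anyᶠ p ≡ anyᶠ q
anyᶠ-cong {zero} e = refl
anyᶠ-cong {suc m} {p} {q} e = trans (anyᶠ-suc p) (trans (cong₂ _∨_ (e zero) (anyᶠ-cong (λ i → e (suc i)))) (sym (anyᶠ-suc q)))

anyᶠ-false : ∀ {m} (p : Fin m → Bool) → (∀ i → p i ≡ false) → anyᶠ p ≡ false
anyᶠ-false {zero} p e = refl
anyᶠ-false {suc m} p e = trans (anyᶠ-suc p) (cong₂ _∨_ (e zero) (anyᶠ-false (λ i → p (suc i)) (λ i → e (suc i))))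

anyᶠ-wit : ∀ {m} (p : Fin m → Bool) i → p i ≡ true → anyᶠ p ≡ true
anyᶠ-wit {suc m} p zero e = trans (anyᶠ-suc p) (cong (_∨ anyᶠ (λ i → p (suc i))) e)
anyᶠ-wit {suc m} p (suc i) e = trans (anyᶠ-suc p) (trans (cong (p zero ∨_) (anyᶠ-wit (λ i → p (suc i)) i e)) (∨-zeroʳ (p zero)))

hasLarger-∷ : ∀ {n} c (b : Vec ℕ n) i r → hasLarger (c ∷ b) (suc i) r ≡ hasLarger b i r
hasLarger-∷ c b i r = anyᶠ-suc (λ j → (toℕ (suc i) <ᵇ toℕ j) ∧ (lookup (c ∷ b) j ≡ᵇ r))

hasLarger-punchIn : ∀ {n} q (b : Vec ℕ n) i r → hasLarger (V.map (punchIn q) b) i (punchIn q r) ≡ hasLarger b i r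
hasLarger-punchIn q b i r = anyᶠ-cong (λ j → cong (λ x → (toℕ i <ᵇ toℕ j) ∧ x)
  (trans (cong (_≡ᵇ punchIn q r) (lookup-map j (punchIn q) b)) (≡ᵇ-punchIn q (lookup b j) r)))

hasLarger-punchIn-self : ∀ {n} q (b : Vec ℕ n) i → hasLarger (V.map (punchIn q) b) i q ≡ false
hasLarger-punchIn-self q b i = anyᶠ-false _ (λ j → trans (cong (λ x → (toℕ i <ᵇ toℕ j) ∧ x)
  (trans (cong (_≡ᵇ q) (lookup-map j (punchIn q) b)) (≡ᵇ-punchIn-self q (lookup b j)))) (∧-zeroʳ _))

startFrom≡afterLast : ∀ {n} (b : Vec ℕ n) i y → startFrom b i y ≡ afterLast (hasLarger b i) y
startFrom≡afterLast b i zero = refl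
startFrom≡afterLast b i (suc y) = cong (λ z → if hasLarger b i y then suc y else z) (startFrom≡afterLast b i y)

αAtMin-∷ : ∀ {n} g (γ : Vec ℤ n) c (b : Vec ℕ n) r → αAtMin (g ∷ γ) (c ∷ b) r ≡ (if c ≡ᵇ r then g else αAtMin γ b r)
αAtMin-∷ g γ c b r = foldr-allFin-suc (λ i acc → if lookup (c ∷ b) i ≡ᵇ r then lookup (g ∷ γ) i else acc) (+ 0)

αAtMin-cong : ∀ {n} (γ : Vec ℤ n) (b b' : Vec ℕ n) r r' → (∀ i → (lookup b i ≡ᵇ r) ≡ (lookup b' i ≡ᵇ r')) →
  αAtMin γ b r ≡ αAtMin γ b' r'
αAtMin-cong [] [] [] r r' e = refl
αAtMin-cong (g ∷ γ) (c ∷ b) (c' ∷ b') r r' e =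
  trans (αAtMin-∷ g γ c b r) (trans (cong₂ (λ x y → if x then g else y) (e zero) (αAtMin-cong γ b b' r r' (λ i → e (suc i))))
    (sym (αAtMin-∷ g γ c' b' r')))

αAtMin-punchIn : ∀ {n} q (γ : Vec ℤ n) (b : Vec ℕ n) r → αAtMin γ (V.map (punchIn q) b) (punchIn q r) ≡ αAtMin γ b r
αAtMin-punchIn q γ b r = αAtMin-cong γ (V.map (punchIn q) b) b (punchIn q r) r (λ i → trans (cong (_≡ᵇ punchIn q r) (lookup-map i (punchIn q) b)) (≡ᵇ-punchIn q (lookup b i) r))

isFirstOf : ∀ {n} → Vec ℕ n → Fin n → ℕ → Bool
isFirstOf (c ∷ b) zero r = c ≡ᵇ r
isFirstOf (c ∷ b) (suc j) r = not (c ≡ᵇ r) ∧ isFirstOf b j r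

αAtMin-addAt : ∀ {n} (γ : Vec ℤ n) (b : Vec ℕ n) j a r →
  αAtMin (addAt j a γ) b r ≡ αAtMin γ b r + (if isFirstOf b j r then a else + 0)
αAtMin-addAt (g ∷ γ) (c ∷ b) zero a r = trans (αAtMin-∷ (g + a) γ c b r) (trans (case (c ≡ᵇ r)) (cong (_+ (if c ≡ᵇ r then a else + 0)) (sym (αAtMin-∷ g γ c b r))))
  where case : ∀ t → (if t then g + a else αAtMin γ b r) ≡ (if t then g else αAtMin γ b r) + (if t then a else + 0)
        case true = refl
        case false = sym (ℤP.+-identityʳ _)
αAtMin-addAt (g ∷ γ) (c ∷ b) (suc j) a r = trans (αAtMin-∷ g (addAt j a γ) c b r)
  (trans (case (c ≡ᵇ r)) (cong (_+ (if not (c ≡ᵇ r) ∧ isFirstOf b j r then a else + 0)) (sym (αAtMin-∷ g γ c b r))))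
  where case : ∀ t → (if t then g else αAtMin (addAt j a γ) b r) ≡ (if t then g else αAtMin γ b r) + (if not t ∧ isFirstOf b j r then a else + 0)
        case true = sym (ℤP.+-identityʳ _)
        case false = αAtMin-addAt γ b j a r

αAtMin-first : ∀ {n} (γ : Vec ℤ n) (b : Vec ℕ n) j r → isFirstOf b j r ≡ true → αAtMin γ b r ≡ lookup γ j
αAtMin-first (g ∷ γ) (c ∷ b) zero r e = trans (αAtMin-∷ g γ c b r) (cong (λ t → if t then g else αAtMin γ b r) e)
αAtMin-first (g ∷ γ) (c ∷ b) (suc j) r e = trans (αAtMin-∷ g γ c b r) (helper (c ≡ᵇ r) e)
  where helper : ∀ t → (not t ∧ isFirstOf b j r) ≡ true → (if t then g else αAtMin γ b r) ≡ lookup γ j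
        helper true ()
        helper false e = αAtMin-first γ b j r e

isFirstOf-min : ∀ {n} (b : Vec ℕ n) j r → (∀ k → toℕ k < toℕ j → lookup b k ≢ lookup b j) →
  isFirstOf b j r ≡ (lookup b j ≡ᵇ r)
isFirstOf-min (c ∷ b) zero r h = refl
isFirstOf-min (c ∷ b) (suc j) r h with lookup b j ≡ᵇ r in eq
... | true = trans (cong₂ (λ x y → not x ∧ y) (≡ᵇ-false (λ e → h zero (s≤s z≤n) (trans e (sym (≡ᵇ-true⇒ eq)))))
                                                 (trans (isFirstOf-min b j r (λ k lt → h (suc k) (s≤s lt))) eq)) refl
... | false = trans (cong (not (c ≡ᵇ r) ∧_) (trans (isFirstOf-min b j r (λ k lt → h (suc k) (s≤s lt))) eq)) (∧-zeroʳ _)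

-- Writing tails as indicator sums over a fixed range r < N turns renumberings of blocks into
-- reindexings of sumN.
tail≡sumN : ∀ {n} (α : Vec ℤ n) (b : Vec ℕ n) i N → lookup b i < N →
  tail α b i ≡ sumN N (λ r → if inRange (afterLast (hasLarger b i) (lookup b i)) (lookup b i) r then αAtMin α b r else + 0)
tail≡sumN α b i N lt = trans (cong (λ m → sumℤ (map (αAtMin α b) (rangeℕ m (lookup b i)))) (startFrom≡afterLast b i (lookup b i)))
  (sum-rangeℕ (αAtMin α b) _ (lookup b i) N (afterLast-≤ (hasLarger b i) (lookup b i)) lt)

-- Every block before that of 1 contains a larger element, so the tail of 1 is α₁.
tail-zero : ∀ {n} {S} a (β : Vec ℤ n) (b : Vec ℕ (suc n)) → IsMarkedOSP S b → tail (a ∷ β) b zero ≡ a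
tail-zero {n} a β (c ∷ b) osp = trans (cong (λ m → sumℤ (map (αAtMin (a ∷ β) (c ∷ b)) (rangeℕ m c))) startFrom≡c)
  (trans (cong (λ k → sumℤ (map (αAtMin (a ∷ β) (c ∷ b)) (map (c N.+_) (upTo k)))) (NP.m+n∸n≡m 1 c))
  (trans (ℤP.+-identityʳ _) (trans (cong (αAtMin (a ∷ β) (c ∷ b)) (NP.+-identityʳ c))
  (trans (αAtMin-∷ a β c b c) (cong (λ t → if t then a else αAtMin β b c) (≡ᵇ-refl c))))))
  where
  earlier-blocks-have-larger : ∀ r → r < c → hasLarger (c ∷ b) zero r ≡ true
  earlier-blocks-have-larger r lt with IsMarkedOSP.blocksNonempty osp zero r lt
  ... | zero , e = ⊥-elim (NP.<⇒≢ lt (sym e))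
  ... | suc t , e = anyᶠ-wit (λ j → (toℕ {suc n} zero <ᵇ toℕ j) ∧ (lookup (c ∷ b) j ≡ᵇ r)) (suc t) (cong (λ x → true ∧ x) (trans (cong (_≡ᵇ r) e) (≡ᵇ-refl r)))
  startFrom≡c : startFrom (c ∷ b) zero c ≡ c
  startFrom≡c = trans (startFrom≡afterLast (c ∷ b) zero c) (afterLast-all (hasLarger (c ∷ b) zero) c earlier-blocks-have-larger)

ospTerm-∷ : ∀ {n} {S} a (β : Vec ℤ n) (b : Vec ℕ (suc n)) → IsMarkedOSP S b →
  ospTerm (a ∷ β) b ≡ a * Πᶠ (λ i → tail (a ∷ β) b (suc i))
ospTerm-∷ a β b osp = trans (Πᶠ-suc (tail (a ∷ β) b)) (cong (_* Πᶠ (λ i → tail (a ∷ β) b (suc i))) (tail-zero a β b osp))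

blockCount : ∀ {n} → Vec ℕ n → ℕ
blockCount [] = 0
blockCount (x ∷ b) = suc x ⊔ blockCount b

lookup<blockCount : ∀ {n} (b : Vec ℕ n) i → lookup b i < blockCount b
lookup<blockCount (x ∷ b) zero = NP.m≤m⊔n (suc x) (blockCount b)
lookup<blockCount (x ∷ b) (suc i) = NP.≤-trans (lookup<blockCount b i) (NP.m≤n⊔m (suc x) (blockCount b))

blockCount-witness : ∀ {n} (b : Vec ℕ n) r → r < blockCount b → ∃ λ t → r ≤ lookup b t
blockCount-witness (x ∷ b) r lt with NP.≤-total (suc x) (blockCount b)
... | inj₁ le = let (t , p) = blockCount-witness b r (subst (r <_) (NP.m≤n⇒m⊔n≡n le) lt) in suc t , p
... | inj₂ le = zero , NP.≤-pred (subst (r <_) (NP.m≥n⇒m⊔n≡m le) lt)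

blockCount-≤ : ∀ {n} (b : Vec ℕ n) c → (∀ t → lookup b t < c) → blockCount b ≤ c
blockCount-≤ [] c h = z≤n
blockCount-≤ (x ∷ b) c h = NP.⊔-lub (h zero) (blockCount-≤ b c (λ t → h (suc t)))

newLastBlock : ∀ {n} → Vec ℕ n → Vec ℕ (suc n)
newLastBlock b = blockCount b ∷ b

newBlockAt : ∀ {n} → Fin n → Vec ℕ n → Vec ℕ (suc n)
newBlockAt j b = lookup b j ∷ V.map (punchIn (lookup b j)) b

joinBlockOf : ∀ {n} → Fin n → Vec ℕ n → Vec ℕ (suc n)
joinBlockOf j b = lookup b j ∷ b

tail-suc-same : ∀ {n} a (β : Vec ℤ n) c (b : Vec ℕ n) (γ : Vec ℤ n) i →
  (∀ r → r ≤ lookup b i → (if c ≡ᵇ r then a else αAtMin β b r) ≡ αAtMin γ b r) →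
  tail (a ∷ β) (c ∷ b) (suc i) ≡ tail γ b i
tail-suc-same a β c b γ i h =
  trans (tail≡sumN (a ∷ β) (c ∷ b) (suc i) (suc x) NP.≤-refl)
  (trans (sumN-cong (suc x) (λ r _ → trans (cong (λ m → if inRange m x r then αAtMin (a ∷ β) (c ∷ b) r else + 0) start≡) (term≡ r)))
  (sym (tail≡sumN γ b i (suc x) NP.≤-refl)))
  where
  x = lookup b i
  m = afterLast (hasLarger b i) x
  start≡ : afterLast (hasLarger (c ∷ b) (suc i)) x ≡ m
  start≡ = afterLast-cong (hasLarger-∷ c b i) x
  term≡ : ∀ r → (if inRange m x r then αAtMin (a ∷ β) (c ∷ b) r else + 0) ≡ (if inRange m x r then αAtMin γ b r else + 0)
  term≡ r with inRange m x r in e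
  ... | false = refl
  ... | true = trans (αAtMin-∷ a β c b r) (h r (≤ᵇ-true⇒ _ _ (∧-conicalʳ _ _ e)))

ospTerm-newLastBlock : ∀ {n} {S} a (β : Vec ℤ n) (b : Vec ℕ n) → IsMarkedOSP S (newLastBlock b) →
  ospTerm (a ∷ β) (newLastBlock b) ≡ a * ospTerm β b
ospTerm-newLastBlock a β b osp = trans (ospTerm-∷ a β (newLastBlock b) osp) (cong (a *_) (Πᶠ-cong (λ i →
  tail-suc-same a β (blockCount b) b β i (λ r r≤ → cong (λ t → if t then a else αAtMin β b r)
    (≡ᵇ-false (λ e → NP.<⇒≢ (NP.≤-<-trans r≤ (lookup<blockCount b i)) (sym e)))))))

ospTerm-joinBlockOf : ∀ {n} {S S'} a (β : Vec ℤ n) (b : Vec ℕ n) j → IsMarkedOSP S (joinBlockOf j b) → IsMarkedOSP S' b →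
  lookup S' j ≡ true → lookup β j ≡ + 0 →
  ospTerm (a ∷ β) (joinBlockOf j b) ≡ a * ospTerm (addAt j a β) b
ospTerm-joinBlockOf a β b j osp osp' Sj βj = trans (ospTerm-∷ a β (joinBlockOf j b) osp) (cong (a *_) (Πᶠ-cong (λ i →
  tail-suc-same a β (lookup b j) b (addAt j a β) i (λ r _ → sym (trans (αAtMin-addAt β b j a r)
    (trans (cong (λ t → αAtMin β b r + (if t then a else + 0)) (isFirstOf-min b j r (IsMarkedOSP.markedMin osp' j Sj)))
    (case r (lookup b j ≡ᵇ r) refl)))))))
  where
  case : ∀ r t → (lookup b j ≡ᵇ r) ≡ t → αAtMin β b r + (if t then a else + 0) ≡ (if t then a else αAtMin β b r)
  case r true e = trans (cong (_+ a) (trans (αAtMin-first β b j r (trans (isFirstOf-min b j r (IsMarkedOSP.markedMin osp' j Sj)) e)) βj))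
                        (ℤP.+-identityˡ a)
  case r false e = ℤP.+-identityʳ _

tail-newBlockAt : ∀ {n} a (β : Vec ℤ n) (b : Vec ℕ n) j i →
  (∀ r → isFirstOf b j r ≡ (lookup b j ≡ᵇ r)) →
  tail (a ∷ β) (newBlockAt j b) (suc i) ≡ tail (addAt j a β) b i
tail-newBlockAt {n} a β b j i j-first = begin
  tail (a ∷ β) b′ (suc i)
    ≡⟨ tail≡sumN (a ∷ β) b′ (suc i) (suc N) X<1+N ⟩
  sumN (suc N) (λ r → if inRange (afterLast (hasLarger b′ (suc i)) X) X r then αAtMin (a ∷ β) b′ r else + 0)
    ≡⟨ cong₂ (λ M Y → sumN (suc N) (λ r → if inRange M Y r then αAtMin (a ∷ β) b′ r else + 0)) M≡ X≡ ⟩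
  sumN (suc N) G
    ≡⟨ sumN-punchIn-point N q G (λ r → if inRange m x r then αAtMin β b r else + 0) _ q<N G-at-q G-punchIn ⟩
  sumN N (λ r → (if inRange m x r then αAtMin β b r else + 0) + (if r ≡ᵇ q then (if inRange m x q then a else + 0) else + 0))
    ≡⟨ sumN-cong N (λ r _ → term-addAt r) ⟨
  sumN N (λ r → if inRange m x r then αAtMin (addAt j a β) b r else + 0)
    ≡⟨ tail≡sumN (addAt j a β) b i N x<N ⟨
  tail (addAt j a β) b i
    ∎
  where
  open ≡-Reasoning
  q = lookup b j
  b′ = newBlockAt j b
  x = lookup b i
  X = lookup (V.map (punchIn q) b) i
  m = afterLast (hasLarger b i) x
  N = suc (x N.+ q)
  X≡ : X ≡ punchIn q x
  X≡ = lookup-map i (punchIn q) b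
  M≡ : afterLast (hasLarger b′ (suc i)) X ≡ punchIn (suc q) m
  M≡ = trans (cong (afterLast (hasLarger b′ (suc i))) X≡)
       (trans (afterLast-cong (hasLarger-∷ q (V.map (punchIn q) b) i) (punchIn q x))
       (afterLast-punchIn q (hasLarger (V.map (punchIn q) b) i) (hasLarger b i) (hasLarger-punchIn q b i) (hasLarger-punchIn-self q b i) x))
  G : ℕ → ℤ
  G r = if inRange (punchIn (suc q) m) (punchIn q x) r then αAtMin (a ∷ β) b′ r else + 0
  X<1+N : X < suc N
  X<1+N = subst (_< suc N) (sym X≡) (s≤s (NP.≤-trans (punchIn≤suc q x) (s≤s (NP.m≤m+n x q))))
  x<N : x < N
  x<N = s≤s (NP.m≤m+n x q)
  q<N : q < N
  q<N = s≤s (NP.m≤n+m q x)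
  G-at-q : G q ≡ (if inRange m x q then a else + 0)
  G-at-q = cong₂ (λ t v → if t then v else + 0) (inRange-punchIn-self q m x)
       (trans (αAtMin-∷ a β q (V.map (punchIn q) b) q) (cong (λ t → if t then a else αAtMin β (V.map (punchIn q) b) q) (≡ᵇ-refl q)))
  G-punchIn : ∀ r → G (punchIn q r) ≡ (if inRange m x r then αAtMin β b r else + 0)
  G-punchIn r = cong₂ (λ t v → if t then v else + 0) (inRange-punchIn q m x r)
       (trans (αAtMin-∷ a β q (V.map (punchIn q) b) (punchIn q r))
       (trans (cong (λ t → if t then a else αAtMin β (V.map (punchIn q) b) (punchIn q r)) (trans (≡ᵇ-sym q (punchIn q r)) (≡ᵇ-punchIn-self q r)))
       (αAtMin-punchIn q β b r)))
  split-if : ∀ r u → (r ≡ᵇ q) ≡ u →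
    (if inRange m x r then αAtMin β b r + (if u then a else + 0) else + 0)
      ≡ (if inRange m x r then αAtMin β b r else + 0) + (if u then (if inRange m x q then a else + 0) else + 0)
  split-if r false _ with inRange m x r
  ... | true = refl
  ... | false = refl
  split-if r true e with ≡ᵇ-true⇒ {r} {q} e
  ... | refl with inRange m x r
  ...   | true = refl
  ...   | false = refl
  term-addAt : ∀ r → (if inRange m x r then αAtMin (addAt j a β) b r else + 0)
      ≡ (if inRange m x r then αAtMin β b r else + 0) + (if r ≡ᵇ q then (if inRange m x q then a else + 0) else + 0)
  term-addAt r = trans (cong (λ v → if inRange m x r then v else + 0)
            (trans (αAtMin-addAt β b j a r) (cong (λ t → αAtMin β b r + (if t then a else + 0)) (trans (j-first r) (≡ᵇ-sym q r)))))
          (split-if r (r ≡ᵇ q) refl)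

ospTerm-newBlockAt : ∀ {n} {S S'} a (β : Vec ℤ n) (b : Vec ℕ n) j → IsMarkedOSP S (newBlockAt j b) → IsMarkedOSP S' b →
  lookup S' j ≡ true → ospTerm (a ∷ β) (newBlockAt j b) ≡ a * ospTerm (addAt j a β) b
ospTerm-newBlockAt a β b j osp osp' Sj = trans (ospTerm-∷ a β (newBlockAt j b) osp) (cong (a *_) (Πᶠ-cong (λ i →
  tail-newBlockAt a β b j i (λ r → isFirstOf-min b j r (IsMarkedOSP.markedMin osp' j Sj)))))

mark : ∀ {n} → Fin n → Vec Bool n → Vec Bool n
mark zero (s ∷ S) = true ∷ S
mark (suc j) (s ∷ S) = s ∷ mark j S

mark-at : ∀ {n} j (S : Vec Bool n) → lookup (mark j S) j ≡ true
mark-at zero (s ∷ S) = refl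
mark-at (suc j) (s ∷ S) = mark-at j S

mark-other : ∀ {n} j i (S : Vec Bool n) → i ≢ j → lookup (mark j S) i ≡ lookup S i
mark-other zero zero (s ∷ S) ne = ⊥-elim (ne refl)
mark-other zero (suc i) (s ∷ S) ne = refl
mark-other (suc j) zero (s ∷ S) ne = refl
mark-other (suc j) (suc i) (s ∷ S) ne = mark-other j i S (λ e → ne (cong suc e))

IsBlockMin : ∀ {n} → Vec ℕ n → Fin n → Set
IsBlockMin b j = ∀ k → toℕ k < toℕ j → lookup b k ≢ lookup b j

blockMin-unique : ∀ {n} (b : Vec ℕ n) j j' → IsBlockMin b j → IsBlockMin b j' → lookup b j ≡ lookup b j' → j ≡ j'
blockMin-unique b j j' mj mj' e with NP.<-cmp (toℕ j) (toℕ j')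
... | tri< lt _ _ = ⊥-elim (mj' j lt e)
... | tri≈ _ eq _ = FP.toℕ-injective eq
... | tri> _ _ gt = ⊥-elim (mj j' gt (sym e))

firstOccurrence : ∀ {n} (b : Vec ℕ n) c →
  (Σ (Fin n) λ j → lookup b j ≡ c × (∀ k → toℕ k < toℕ j → lookup b k ≢ c)) ⊎ (∀ t → lookup b t ≢ c)
firstOccurrence [] c = inj₂ λ ()
firstOccurrence (x ∷ b) c with x N.≟ c
... | yes e = inj₁ (zero , e , λ k ())
... | no ne with firstOccurrence b c
...   | inj₁ (j , e , f) = inj₁ (suc j , e , λ { zero _ → ne ; (suc k) (s≤s lt) → f k lt })
...   | inj₂ f = inj₂ λ { zero → ne ; (suc t) → f t }

osp-newLastBlock : ∀ {n} {S : Vec Bool n} (b : Vec ℕ n) → IsMarkedOSP S b → IsMarkedOSP (true ∷ S) (newLastBlock b)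
osp-newLastBlock {n} {S} b o = record { blocksNonempty = nonempty ; minMarked = min⇒marked ; markedMin = marked⇒min }
  where
  nonempty : ∀ i r → r < lookup (newLastBlock b) i → ∃ λ j → lookup (newLastBlock b) j ≡ r
  nonempty zero r lt with blockCount-witness b r lt
  ... | t , le with NP.m≤n⇒m<n∨m≡n le
  ...   | inj₁ lt' = let (j , e) = blocksNonempty o t r lt' in suc j , e
  ...   | inj₂ e = suc t , sym e
  nonempty (suc i) r lt = let (j , e) = blocksNonempty o i r lt in suc j , e
  min⇒marked : ∀ i → (∀ j → toℕ j < toℕ i → lookup (newLastBlock b) j ≢ lookup (newLastBlock b) i) → lookup (true ∷ S) i ≡ true
  min⇒marked zero h = refl
  min⇒marked (suc i) h = minMarked o i (λ k lt → h (suc k) (s≤s lt))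
  marked⇒min : ∀ i → lookup (true ∷ S) i ≡ true → ∀ j → toℕ j < toℕ i → lookup (newLastBlock b) j ≢ lookup (newLastBlock b) i
  marked⇒min zero _ j ()
  marked⇒min (suc i) s zero _ e = NP.<⇒≢ (lookup<blockCount b i) (sym e)
  marked⇒min (suc i) s (suc k) (s≤s lt) e = markedMin o i s k lt e

osp-newBlockAt : ∀ {n} {S : Vec Bool n} (b : Vec ℕ n) j → IsMarkedOSP S b → lookup S j ≡ true →
  IsMarkedOSP (true ∷ S) (newBlockAt j b)
osp-newBlockAt {n} {S} b j o Sj = record { blocksNonempty = nonempty ; minMarked = min⇒marked ; markedMin = marked⇒min }
  where
  q = lookup b j
  lk : ∀ i → lookup (newBlockAt j b) (suc i) ≡ punchIn q (lookup b i)
  lk i = lookup-map i (punchIn q) b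
  from-b : ∀ i r → r ≢ q → punchOut q r < lookup b i → ∃ λ t → lookup (newBlockAt j b) t ≡ r
  from-b i r ne lt = let (t , e) = blocksNonempty o i (punchOut q r) lt in suc t , trans (lk t) (trans (cong (punchIn q) e) (punchIn-punchOut q r ne))
  nonempty : ∀ i r → r < lookup (newBlockAt j b) i → ∃ λ t → lookup (newBlockAt j b) t ≡ r
  nonempty zero r lt = from-b j r (NP.<⇒≢ lt) (subst (_< q) (sym (trans (cong (punchOut q) (sym (punchIn-< q r lt))) (punchOut-punchIn q r))) lt)
  nonempty (suc i) r lt with r N.≟ q
  ... | yes e = zero , sym e
  ... | no ne = from-b i r ne (punchIn-cancel-< q (subst (_< punchIn q (lookup b i)) (sym (punchIn-punchOut q r ne)) (subst (r <_) (lk i) lt)))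
  min⇒marked : ∀ i → (∀ k → toℕ k < toℕ i → lookup (newBlockAt j b) k ≢ lookup (newBlockAt j b) i) → lookup (true ∷ S) i ≡ true
  min⇒marked zero h = refl
  min⇒marked (suc i) h = minMarked o i (λ k lt e → h (suc k) (s≤s lt) (trans (lk k) (trans (cong (punchIn q) e) (sym (lk i)))))
  marked⇒min : ∀ i → lookup (true ∷ S) i ≡ true → ∀ k → toℕ k < toℕ i → lookup (newBlockAt j b) k ≢ lookup (newBlockAt j b) i
  marked⇒min zero _ k ()
  marked⇒min (suc i) s zero _ e = punchIn-≢ q (lookup b i) (sym (trans e (lk i)))
  marked⇒min (suc i) s (suc k) (s≤s lt) e = markedMin o i s k lt (punchIn-injective q (trans (sym (lk k)) (trans e (lk i))))

osp-joinBlockOf : ∀ {n} {S : Vec Bool n} (b : Vec ℕ n) j → IsMarkedOSP (mark j S) b →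
  lookup S j ≡ false → IsMarkedOSP (true ∷ S) (joinBlockOf j b)
osp-joinBlockOf {n} {S} b j o Sj = record { blocksNonempty = nonempty ; minMarked = min⇒marked ; markedMin = marked⇒min }
  where
  q = lookup b j
  nonempty : ∀ i r → r < lookup (joinBlockOf j b) i → ∃ λ t → lookup (joinBlockOf j b) t ≡ r
  nonempty zero r lt = let (t , e) = blocksNonempty o j r lt in suc t , e
  nonempty (suc i) r lt = let (t , e) = blocksNonempty o i r lt in suc t , e
  min⇒marked : ∀ i → (∀ k → toℕ k < toℕ i → lookup (joinBlockOf j b) k ≢ lookup (joinBlockOf j b) i) → lookup (true ∷ S) i ≡ true
  min⇒marked zero h = refl
  min⇒marked (suc i) h with FP._≟_ i j
  ... | yes refl = ⊥-elim (h zero (s≤s z≤n) refl)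
  ... | no ne = trans (sym (mark-other j i S ne)) (minMarked o i (λ k lt → h (suc k) (s≤s lt)))
  marked⇒min : ∀ i → lookup (true ∷ S) i ≡ true → ∀ k → toℕ k < toℕ i → lookup (joinBlockOf j b) k ≢ lookup (joinBlockOf j b) i
  marked⇒min zero _ k ()
  marked⇒min (suc i) s k lt with FP._≟_ i j
  marked⇒min (suc i) s k lt | yes refl = ⊥-elim (true≢false (trans (sym s) Sj))
  marked⇒min (suc i) s zero lt | no ne = λ e → ne (blockMin-unique b i j
      (markedMin o i (trans (mark-other j i S ne) s)) (markedMin o j (mark-at j S)) (sym e))
  marked⇒min (suc i) s (suc k) (s≤s lt) | no ne = markedMin o i (trans (mark-other j i S ne) s) k lt

-- Position 0 (the element 1) forms a new last block, a new block just before the block of a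
-- marked j, or joins the block of an unmarked j, which is a block minimum once 1 is removed.
InsertionOf : ∀ {n} → Vec Bool n → Vec ℕ (suc n) → Set
InsertionOf {n} S B = (∃ λ b → IsMarkedOSP S b × newLastBlock b ≡ B) ⊎
  (∃ λ (j : Fin n) → (lookup S j ≡ true × ∃ λ b → IsMarkedOSP S b × newBlockAt j b ≡ B)
                   ⊎ (lookup S j ≡ false × ∃ λ b → IsMarkedOSP (mark j S) b × joinBlockOf j b ≡ B))

module _ {n} {S : Vec Bool n} {c} {b : Vec ℕ n} (o : IsMarkedOSP (true ∷ S) (c ∷ b)) where

  osp-joined-unmarked : ∀ {j} → lookup b j ≡ c → lookup S j ≡ false
  osp-joined-unmarked {j} e = ≢true⇒false (λ s → markedMin o (suc j) s zero (s≤s z≤n) (sym e))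

  osp-joined : ∀ {j} → lookup b j ≡ c → (∀ k → toℕ k < toℕ j → lookup b k ≢ c) → IsMarkedOSP (mark j S) b
  osp-joined {j} e first = record { blocksNonempty = nonempty ; minMarked = min⇒marked ; markedMin = marked⇒min }
    where
    nonempty : ∀ i r → r < lookup b i → ∃ λ t → lookup b t ≡ r
    nonempty i r lt with blocksNonempty o (suc i) r lt
    ... | zero , e₀ = j , trans e e₀
    ... | suc t , eₜ = t , eₜ
    min⇒marked : ∀ i → (∀ k → toℕ k < toℕ i → lookup b k ≢ lookup b i) → lookup (mark j S) i ≡ true
    min⇒marked i h with i FP.≟ j
    ... | yes refl = mark-at j S
    ... | no i≢j = trans (mark-other j i S i≢j) (minMarked o (suc i) min)
      where
      min : ∀ k → toℕ k < toℕ (suc i) → lookup (c ∷ b) k ≢ lookup (c ∷ b) (suc i)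
      min zero _ ec with NP.<-cmp (toℕ i) (toℕ j)
      ... | tri< lt _ _ = first i lt (sym ec)
      ... | tri≈ _ eq _ = i≢j (FP.toℕ-injective eq)
      ... | tri> _ _ gt = h j gt (trans e ec)
      min (suc k) (s≤s lt) = h k lt
    marked⇒min : ∀ i → lookup (mark j S) i ≡ true → ∀ k → toℕ k < toℕ i → lookup b k ≢ lookup b i
    marked⇒min i s k lt with i FP.≟ j
    ... | yes refl = λ ek → first k lt (trans ek e)
    ... | no i≢j = markedMin o (suc i) (trans (sym (mark-other j i S i≢j)) s) (suc k) (s≤s lt)

  module _ (notin : ∀ t → lookup b t ≢ c) where

    private
      b′ = V.map (punchOut c) b

      lookup-b′ : ∀ t → lookup b′ t ≡ punchOut c (lookup b t)
      lookup-b′ t = lookup-map t (punchOut c) b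

      lookup-b : ∀ t → lookup b t ≡ punchIn c (lookup b′ t)
      lookup-b t = trans (sym (punchIn-punchOut c (lookup b t) (notin t))) (cong (punchIn c) (sym (lookup-b′ t)))

      first-suc : ∀ {i} → (∀ k → toℕ k < toℕ i → lookup b′ k ≢ lookup b′ i) →
        ∀ k → toℕ k < toℕ (suc i) → lookup (c ∷ b) k ≢ lookup (c ∷ b) (suc i)
      first-suc {i} h zero _ ec = notin i (sym ec)
      first-suc {i} h (suc k) (s≤s lt) ek = h k lt (trans (lookup-b′ k) (trans (cong (punchOut c) ek) (sym (lookup-b′ i))))

    osp-punchOut : IsMarkedOSP S b′
    osp-punchOut = record
      { blocksNonempty = nonempty
      ; minMarked = λ i h → minMarked o (suc i) (first-suc h)
      ; markedMin = λ i s k lt ek → markedMin o (suc i) s (suc k) (s≤s lt)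
          (trans (lookup-b k) (trans (cong (punchIn c) ek) (sym (lookup-b i))))
      }
      where
      nonempty : ∀ i r → r < lookup b′ i → ∃ λ t → lookup b′ t ≡ r
      nonempty i r lt with blocksNonempty o (suc i) (punchIn c r) (subst (punchIn c r <_) (sym (lookup-b i)) (punchIn-mono-< c lt))
      ... | zero , e₀ = ⊥-elim (punchIn-≢ c r (sym e₀))
      ... | suc t , eₜ = t , trans (lookup-b′ t) (trans (cong (punchOut c) eₜ) (punchOut-punchIn c r))

    osp-punchOut-marked : ∀ {j} → lookup b′ j ≡ c → (∀ k → toℕ k < toℕ j → lookup b′ k ≢ c) → lookup S j ≡ true
    osp-punchOut-marked {j} e first = minMarked o (suc j) (first-suc (λ k lt ek → first k lt (trans ek e)))

    module _ (notin′ : ∀ t → lookup b′ t ≢ c) where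

      punchOut-below : ∀ t → lookup b′ t < c
      punchOut-below t with NP.<-cmp (lookup b′ t) c
      ... | tri< lt _ _ = lt
      ... | tri≈ _ eq _ = ⊥-elim (notin′ t eq)
      ... | tri> _ _ gt = ⊥-elim (let (t′ , e′) = blocksNonempty osp-punchOut t c gt in notin′ t′ e′)

      blockCount-punchOut : blockCount b′ ≡ c
      blockCount-punchOut = NP.≤-antisym (blockCount-≤ b′ c punchOut-below) (c≤ c refl)
        where
        c≤ : ∀ c′ → c′ ≡ c → c′ ≤ blockCount b′
        c≤ zero _ = z≤n
        c≤ (suc c′) refl with blocksNonempty o zero c′ NP.≤-refl
        ... | zero , e₀ = ⊥-elim (NP.1+n≢n e₀)
        ... | suc t , eₜ = NP.≤-trans (s≤s (NP.≤-reflexive (sym (trans (lookup-b′ t) (trans (cong (punchOut (suc c′)) eₜ)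
              (trans (cong (punchOut (suc c′)) (sym (punchIn-< (suc c′) c′ NP.≤-refl))) (punchOut-punchIn (suc c′) c′)))))))
              (lookup<blockCount b′ t)

insertion-cases : ∀ {n} {S : Vec Bool n} (B : Vec ℕ (suc n)) → IsMarkedOSP (true ∷ S) B → InsertionOf S B
insertion-cases {n} {S} (c ∷ b) o with firstOccurrence b c
... | inj₁ (j , e , first) =
  inj₂ (j , inj₂ (osp-joined-unmarked o e , b , osp-joined o e first , cong (_∷ b) e))
... | inj₂ notin with firstOccurrence (V.map (punchOut c) b) c
...   | inj₁ (j , e , first) = inj₂ (j , inj₁ (osp-punchOut-marked o notin e first , _ , osp-punchOut o notin ,
          cong₂ _∷_ e (trans (cong (λ q → V.map (punchIn q) _) e) (map-punchIn-punchOut b c notin))))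
...   | inj₂ notin′ = inj₁ (_ , osp-punchOut o notin , cong₂ _∷_ (blockCount-punchOut o notin notin′)
          (trans (sym (map-punchIn-above _ c (punchOut-below o notin notin′))) (map-punchIn-punchOut b c notin)))

mutual
  osps : ∀ n → Vec Bool n → List (Vec ℕ n)
  osps zero [] = [] ∷ []
  osps (suc n) (false ∷ S) = []
  osps (suc n) (true ∷ S) = map newLastBlock (osps n S) ++ concatᶠ (λ j → ospsAt n S j (lookup S j))

  ospsAt : ∀ n → Vec Bool n → Fin n → Bool → List (Vec ℕ (suc n))
  ospsAt n S j true = map (newBlockAt j) (osps n S)
  ospsAt n S j false = map (joinBlockOf j) (osps n (mark j S))

InsertedAt : ∀ {n} → Vec Bool n → Fin n → Vec ℕ (suc n) → Set
InsertedAt S j B = (lookup S j ≡ true × ∃ λ b → IsMarkedOSP S b × newBlockAt j b ≡ B)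
         ⊎ (lookup S j ≡ false × ∃ λ b → IsMarkedOSP (mark j S) b × joinBlockOf j b ≡ B)

newBlockAt-injective : ∀ {n} j {b1 b2 : Vec ℕ n} → newBlockAt j b1 ≡ newBlockAt j b2 → b1 ≡ b2
newBlockAt-injective j {b1} {b2} e = map-punchIn-injective (lookup b1 j)
  (trans (cong V.tail e) (cong (λ q → V.map (punchIn q) b2) (sym (cong V.head e))))

insertedAt-unique : ∀ {n} (S : Vec Bool n) B j j' → InsertedAt S j B → InsertedAt S j' B → j ≡ j'
insertedAt-unique S B j j' (inj₁ (s , b1 , o1 , e1)) (inj₁ (s' , b2 , o2 , e2)) =
  blockMin-unique b1 j j' (IsMarkedOSP.markedMin o1 j s) (IsMarkedOSP.markedMin o1 j' s')
    (trans (cong V.head B≡) (cong (λ v → lookup v j') (sym b₁≡b₂)))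
  where
  B≡ = trans e1 (sym e2)
  b₁≡b₂ : b1 ≡ b2
  b₁≡b₂ = map-punchIn-injective (lookup b1 j) (trans (cong V.tail B≡) (cong (λ q → V.map (punchIn q) b2) (sym (cong V.head B≡))))
insertedAt-unique S B j j' (inj₁ (s , b1 , o1 , e1)) (inj₂ (s' , b2 , o2 , e2)) = ⊥-elim (punchIn-≢ (lookup b1 j) (lookup b1 j')
  (trans (sym (lookup-map j' (punchIn (lookup b1 j)) b1)) (trans (cong (λ v → lookup v j') (cong V.tail B≡)) (sym (cong V.head B≡)))))
  where B≡ = trans e1 (sym e2)
insertedAt-unique S B j j' (inj₂ (s , b1 , o1 , e1)) (inj₁ (s' , b2 , o2 , e2)) = ⊥-elim (punchIn-≢ (lookup b2 j') (lookup b2 j)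
  (trans (sym (lookup-map j (punchIn (lookup b2 j')) b2)) (trans (cong (λ v → lookup v j) (cong V.tail B≡)) (sym (cong V.head B≡)))))
  where B≡ = trans e2 (sym e1)
insertedAt-unique S B j j' (inj₂ (s , b1 , o1 , e1)) (inj₂ (s' , b2 , o2 , e2)) =
  blockMin-unique b1 j j' (IsMarkedOSP.markedMin o1 j (mark-at j S)) (subst (λ v → IsBlockMin v j') (sym b₁≡b₂) (IsMarkedOSP.markedMin o2 j' (mark-at j' S)))
    (trans (cong V.head B≡) (cong (λ v → lookup v j') (sym b₁≡b₂)))
  where
  B≡ = trans e1 (sym e2)
  b₁≡b₂ = cong V.tail B≡

enum-osps : ∀ n (S : Vec Bool n) → Enumerates (IsMarkedOSP S) (osps n S)
enum-osps zero [] = ([] ∷ []) , (λ { [] (here refl) → osp-empty }) , λ { [] _ → here refl }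
  where osp-empty : IsMarkedOSP [] []
        osp-empty = record { blocksNonempty = λ () ; minMarked = λ () ; markedMin = λ () }
enum-osps (suc n) (false ∷ S) = enum-empty λ B o → true≢false (sym (IsMarkedOSP.minMarked o zero (λ k ())))
enum-osps (suc n) (true ∷ S) = enum-++
  (enum-map newLastBlock (λ e → cong V.tail e) (enum-osps n S) (λ b o → b , o , refl) (λ B (b , o , e) → b , o , e))
  (enum-concatᶠ (InsertedAt S) (λ j → ospsAt n S j (lookup S j)) (λ j → enum-ospsAt j (lookup S j) refl)
     (λ B j j' q q' → insertedAt-unique S B j j' q q') (λ B p → p) (λ B j q → j , q))
  lastBlock-disjoint
  (λ B o → insertion-cases B o)
  (λ { B (b , o , refl) → osp-newLastBlock b o })
  (λ { B (j , inj₁ (s , b , o , refl)) → osp-newBlockAt b j o s ; B (j , inj₂ (s , b , o , refl)) → osp-joinBlockOf b j o s })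
  where
  enum-ospsAt : ∀ j t → lookup S j ≡ t → Enumerates (InsertedAt S j) (ospsAt n S j t)
  enum-ospsAt j true s = enum-map (newBlockAt j) (newBlockAt-injective j) (enum-osps n S) (λ b o → inj₁ (s , b , o , refl))
    λ { B (inj₁ (_ , b , o , e)) → b , o , e ; B (inj₂ (s' , _)) → ⊥-elim (true≢false (trans (sym s) s')) }
  enum-ospsAt j false s = enum-map (joinBlockOf j) (λ e → cong V.tail e) (enum-osps n (mark j S)) (λ b o → inj₂ (s , b , o , refl))
    λ { B (inj₂ (_ , b , o , e)) → b , o , e ; B (inj₁ (s' , _)) → ⊥-elim (true≢false (trans (sym s') s)) }
  lastBlock-disjoint : ∀ B → (∃ λ b → IsMarkedOSP S b × newLastBlock b ≡ B) → (∃ λ j → InsertedAt S j B) → ⊥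
  lastBlock-disjoint B (b1 , o1 , e1) (j , inj₁ (s , b2 , o2 , e2)) =
    NP.<⇒≱ (lookup<blockCount b1 j) (NP.≤-trans (NP.n≤1+n (blockCount b1)) (NP.≤-reflexive (sym (trans (trans (cong (λ v → lookup v j) (cong V.tail B≡))
        (lookup-map j (punchIn (lookup b2 j)) b2)) (trans (punchIn-≥ (lookup b2 j) (lookup b2 j) NP.≤-refl) (cong suc (sym (cong V.head B≡))))))))
    where B≡ = trans e1 (sym e2)
  lastBlock-disjoint B (b1 , o1 , e1) (j , inj₂ (s , b2 , o2 , e2)) =
    NP.<⇒≢ (lookup<blockCount b1 j) (trans (cong (λ v → lookup v j) (cong V.tail B≡)) (sym (cong V.head B≡)))
    where B≡ = trans e1 (sym e2)

SupportIn : ∀ {n} → Vec ℤ n → Vec Bool n → Set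
SupportIn γ S = ∀ i → lookup γ i ≢ + 0 → lookup S i ≡ true

sum-osps : ∀ n (S : Vec Bool n) (γ : Vec ℤ n) → SupportIn γ S → sumℤ (map (ospTerm γ) (osps n S)) ≡ tesRec n γ
sum-osps zero [] [] sub = refl
sum-osps (suc n) (false ∷ S) (a ∷ β) sub with a ≟ + 0
... | yes refl = sym (ℤP.*-zeroˡ (tesRec n β + Σᶠ (λ j → tesRec n (addAt j (+ 0) β))))
... | no a≢0 = ⊥-elim (true≢false (sym (sub zero a≢0)))
sum-osps (suc n) (true ∷ S) (a ∷ β) sub = begin
  sumℤ (map (ospTerm (a ∷ β)) (map newLastBlock (osps n S) ++ concatᶠ parts))
    ≡⟨ sum-++ (ospTerm (a ∷ β)) (map newLastBlock (osps n S)) (concatᶠ parts) ⟩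
  sumℤ (map (ospTerm (a ∷ β)) (map newLastBlock (osps n S))) + sumℤ (map (ospTerm (a ∷ β)) (concatᶠ parts))
    ≡⟨ cong₂ _+_ sum-newLastBlock (sum-concatᶠ (ospTerm (a ∷ β)) parts) ⟩
  a * tesRec n β + Σᶠ (λ j → sumℤ (map (ospTerm (a ∷ β)) (parts j)))
    ≡⟨ cong (λ e → a * tesRec n β + e) (Σᶠ-cong (λ j → sum-part j (lookup S j) refl)) ⟩
  a * tesRec n β + Σᶠ (λ j → a * tesRec n (addAt j a β))
    ≡⟨ cong (λ e → a * tesRec n β + e) (Σᶠ-*ˡ a (λ j → tesRec n (addAt j a β))) ⟩
  a * tesRec n β + a * Σᶠ (λ j → tesRec n (addAt j a β))
    ≡⟨ ℤP.*-distribˡ-+ a (tesRec n β) (Σᶠ (λ j → tesRec n (addAt j a β))) ⟨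
  a * (tesRec n β + Σᶠ (λ j → tesRec n (addAt j a β)))
    ∎
  where
  open ≡-Reasoning
  parts : Fin n → List (Vec ℕ (suc n))
  parts j = ospsAt n S j (lookup S j)
  subβ : SupportIn β S
  subβ i ne = sub (suc i) ne
  sound : ∀ {S′} {b} → b ∈ osps n S′ → IsMarkedOSP S′ b
  sound {S′} {b} = proj₁ (proj₂ (enum-osps n S′)) b
  sum-newLastBlock : sumℤ (map (ospTerm (a ∷ β)) (map newLastBlock (osps n S))) ≡ a * tesRec n β
  sum-newLastBlock = trans (sum-map-* (ospTerm (a ∷ β)) newLastBlock a (ospTerm β) (osps n S)
      (λ b b∈ → ospTerm-newLastBlock a β b (osp-newLastBlock b (sound b∈))))
    (cong (a *_) (sum-osps n S β subβ))
  sum-part : ∀ j t → lookup S j ≡ t → sumℤ (map (ospTerm (a ∷ β)) (ospsAt n S j t)) ≡ a * tesRec n (addAt j a β)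
  sum-part j true Sj = trans (sum-map-* (ospTerm (a ∷ β)) (newBlockAt j) a (ospTerm (addAt j a β)) (osps n S)
      (λ b b∈ → ospTerm-newBlockAt a β b j (osp-newBlockAt b j (sound b∈) Sj) (sound b∈) Sj))
    (cong (a *_) (sum-osps n S (addAt j a β) sub′))
    where
    sub′ : SupportIn (addAt j a β) S
    sub′ i ne with i FP.≟ j
    ... | yes refl = Sj
    ... | no i≢j = subβ i (λ e → ne (trans (lookup-addAt-≢ β j a i i≢j) e))
  sum-part j false Sj = trans (sum-map-* (ospTerm (a ∷ β)) (joinBlockOf j) a (ospTerm (addAt j a β)) (osps n (mark j S))
      (λ b b∈ → ospTerm-joinBlockOf a β b j (osp-joinBlockOf b j (sound b∈) Sj) (sound b∈) (mark-at j S) βj≡0))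
    (cong (a *_) (sum-osps n (mark j S) (addAt j a β) sub′))
    where
    βj≡0 : lookup β j ≡ + 0
    βj≡0 with lookup β j ≟ + 0
    ... | yes e = e
    ... | no ne = ⊥-elim (true≢false (trans (sym (subβ j ne)) Sj))
    sub′ : SupportIn (addAt j a β) (mark j S)
    sub′ i ne with i FP.≟ j
    ... | yes refl = mark-at j S
    ... | no i≢j = trans (mark-other j i S i≢j) (subβ i (λ e → ne (trans (lookup-addAt-≢ β j a i i≢j) e)))

sum-ospTerm-marked≡tesRec : ∀ n (S : Vec Bool n) (γ : Vec ℤ n) → SupportIn γ S → ∀ L → Enumerates (IsMarkedOSP S) L →
  sumℤ (map (ospTerm γ) L) ≡ tesRec n γ
sum-ospTerm-marked≡tesRec n S γ sub L e = trans (enum-sum-unique (ospTerm γ) e (enum-osps n S)) (sum-osps n S γ sub)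

support : ∀ {n} → Vec ℤ n → Vec Bool n
support α = V.map isNonzero α

isNonzero⇒≢0 : ∀ x → isNonzero x ≡ true → x ≢ + 0
isNonzero⇒≢0 x e refl = true≢false (sym e)

osp⇒marked : ∀ {n} (α : Vec ℤ n) b → IsOSP α b → IsMarkedOSP (support α) b
osp⇒marked α b o = record
  { blocksNonempty = IsOSP.blocksNonempty o
  ; minMarked = λ i h → trans (lookup-map i isNonzero α) (isNonzero-true _ (IsOSP.minIsSupp o i h))
  ; markedMin = λ i s → IsOSP.suppIsMin o i (isNonzero⇒≢0 _ (trans (sym (lookup-map i isNonzero α)) s)) }

marked⇒osp : ∀ {n} (α : Vec ℤ n) b → IsMarkedOSP (support α) b → IsOSP α b
marked⇒osp α b o = record
  { blocksNonempty = IsMarkedOSP.blocksNonempty o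
  ; minIsSupp = λ i h → isNonzero⇒≢0 _ (trans (sym (lookup-map i isNonzero α)) (IsMarkedOSP.minMarked o i h))
  ; suppIsMin = λ i ne → IsMarkedOSP.markedMin o i (trans (lookup-map i isNonzero α) (isNonzero-true _ ne)) }

enum-osp : ∀ n (α : Vec ℤ n) → ∃ λ L → Enumerates (IsOSP α) L
enum-osp n α = osps n (support α) , enum-⇔ (marked⇒osp α) (osp⇒marked α) (enum-osps n (support α))

sum-ospTerm≡tesRec : ∀ n (α : Vec ℤ n) L → Enumerates (IsOSP α) L → sumℤ (map (ospTerm α) L) ≡ tesRec n α
sum-ospTerm≡tesRec n α L e = sum-ospTerm-marked≡tesRec n (support α) α (λ i ne → trans (lookup-map i isNonzero α) (isNonzero-true _ ne)) L
  (enum-⇔ (osp⇒marked α) (marked⇒osp α) e)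

proposition6p4 : ∀ (m : ℕ) (α : Vec ℤ (suc m)) →
    (∃ λ (L : List (Matrix (suc m))) → Enumerates (IsTesler α) L)
    × (∃ λ (L : List (Vec ℕ (suc m))) → Enumerates (IsOSP α) L)
    × (∀ (Ltes : List (Matrix (suc m))) (Losp : List (Vec ℕ (suc m))) →
        Enumerates (IsTesler α) Ltes → Enumerates (IsOSP α) Losp →
        (sumℤ (map wt₁₁ Ltes) ≡ sumℤ (map (ospTerm α) Losp))
        × (sumℤ (map (ospTerm α) Losp) ≡ productFormula m α))
proposition6p4 m α =
  (teslerMatrices (suc m) α , enum-teslerMatrices (suc m) α) ,
  enum-osp (suc m) α ,
  λ Ltes Losp et eo →
    trans (sum-wt₁₁≡tesRec (suc m) α Ltes et) (sym (sum-ospTerm≡tesRec (suc m) α Losp eo)) ,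
    trans (sum-ospTerm≡tesRec (suc m) α Losp eo) (tesRec≡productFormula m α)
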